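{- Let $d\ge2$, let $p,q$ be integers with $q\ge 2$, $1\le p\le q-1$ and $\gcd(p,q)=1$. For $1\leq i\leq n$ let $\mathcal{O}_i$ be a $\sigma_d$-rotational orbit with rotation number $p/q$, and let $s_i=b^{(i)}_0,b^{(i)}_1,\dots,b^{(i)}_{q-1}$ be its representative sequence. Then $A=\bigcup_{i=1}^n \mathcal{O}_i$ is $\sigma_d$-rotational with rotation number equal to $p/q$ (as a rational number) if and only if the collection of representative sequences $\{s_i\}_{i=1}^n$ can be interlaced.
   Context: $\mathbb{T}=\mathbb{R}/\mathbb{Z}$, totally ordered by representatives in $[0,1)$; $\sigma_d(t)=dt$; the orbit of $t$ is $\{\sigma_d^k(t):k\ge0\}$. A finite set $\{t_0<\dots<t_{m-1}\}$, indices in $\mathbb{Z}/m\mathbb{Z}$, is $\sigma_d$-rotational with rotation number $p'/m$ if $0\ne p'\in\mathbb{Z}/m\mathbb{Z}$ and $\sigma_d(t_i)=t_{i+p'}$ for all $i$. An $r$-sequence of length $k$ is a nondecreasing sequence of length $k$ with entries in $\{0,\dots,r-1\}$. Let $p^*$ be the inverse of $p$ in $\mathbb{Z}/q\mathbb{Z}$. Representative sequence: if $\mathcal{O}$ is a $\sigma_d$-rotational orbit with rotation number $p/q$ and $t=0.\overline{a_0a_1\dots a_{q-1}}$ (base $d$, indices in $\mathbb{Z}/q\mathbb{Z}$) is its least element, its representative sequence is the $(d-1)$-sequence of length $q$ $$a_{0},a_{p^*},\dots,a_{ -(p+1)p^*},\ a_{ -pp^*}-1,\dots, a_{(q-1)p^*}-1,$$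 i.e. the $k$-th term ($0\le k\le q-1$) is $a_{kp^*}$ if $k\le q-p-1$ and $a_{kp^*}-1$ if $k\ge q-p$. A collection of representative sequences $s_i=b_0^{(i)},\dots,b_{q-1}^{(i)}$, $1\le i\le n$, can be interlaced if, after some relabeling (permutation) of the indices $i$, the sequence $b_0^{(1)},\dots,b_0^{(n)},b_1^{(1)},\dots,b_1^{(n)},\dots,b_{q-1}^{(1)},\dots,b_{q-1}^{(n)}$ is a $(d-1)$-sequence (nondecreasing). -}

module Defs where

open import Data.Nat as ℕ using (ℕ; zero; suc; _%_; _∸_)
open import Data.Nat.DivMod using (m%n<n)
open import Data.Integer as ℤ using (ℤ; +_)
open import Data.Rational as ℚ using (ℚ; floor; 0ℚ)
open import Data.Fin as Fin using (Fin; toℕ; fromℕ<)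
open import Data.Fin.Permutation using (Permutation′; _⟨$⟩ʳ_)
open import Data.List using (List; map; concat; allFin)
open import Data.List.Relation.Unary.All using (All)
open import Data.List.Relation.Unary.Sorted.TotalOrder using (Sorted)
open import Data.Nat.Properties using (≤-totalOrder)
open import Data.Product using (Σ; ∃; ∃-syntax; _×_; _,_)
open import Data.Bool using (if_then_else_)
open import Relation.Binary.PropositionalEquality using (_≡_; _≢_)
open import Relation.Nullary using (¬_; Dec; yes; no)
open import Function.Bundles using (_⇔_)

-- Points of 𝕋 = ℝ/ℤ that can lie on a finite σ_d-orbit are rational;
-- we model them by rationals in [0,1).
In𝕋 : ℚ → Set
In𝕋 t = (0ℚ ℚ.≤ t) × (t ℚ.< ℚ.1ℚ)

frac : ℚ → ℚ
frac x = x ℚ.- (floor x ℚ./ 1)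

σ : ℕ → ℚ → ℚ
σ d t = frac ((+ d ℚ./ 1) ℚ.* t)

σ^ : ℕ → ℕ → ℚ → ℚ
σ^ d zero    t = t
σ^ d (suc k) t = σ d (σ^ d k t)

Orbit : ℕ → ℚ → ℚ → Set
Orbit d t x = ∃[ k ] σ^ d k t ≡ x

-- the rational number a/b (b ≥ 1 in all uses; totalised at b = 0)
_÷_ : ℕ → ℕ → ℚ
a ÷ zero  = 0ℚ
a ÷ suc b = + a ℚ./ suc b

_+ₘ_ : ∀ {m} → Fin m → Fin m → Fin m
_+ₘ_ {suc m} i j = fromℕ< (m%n<n (toℕ i ℕ.+ toℕ j) (suc m))

-- A finite set S ⊆ 𝕋 is σ_d-rotational with rotation number r:
-- S = {t_0 < … < t_{m-1}} and there is 0 ≠ p' ∈ ℤ/mℤ with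
-- σ_d(t_i) = t_{i+p'} for all i, and p'/m = r as a rational number.
Rotational : ℕ → (ℚ → Set) → ℚ → Set
Rotational d S r =
  ∃[ m ] Σ (Fin m → ℚ) λ t →
    (∀ i j → i Fin.< j → t i ℚ.< t j) ×
    (∀ x → S x ⇔ (∃[ i ] t i ≡ x)) ×
    (∃[ p′ ] (toℕ p′ ≢ 0) × (∀ i → σ d (t i) ≡ t (i +ₘ p′)) × (toℕ p′ ÷ m ≡ r))

IsLeast : (ℚ → Set) → ℚ → Set
IsLeast S t = S t × (∀ x → S x → t ℚ.≤ x)

-- j-th base-d digit of t ∈ [0,1): ⌊d σ_d^j(t)⌋  (so t = 0.a₀a₁a₂… in base d)
digit : ℕ → ℚ → ℕ → ℕ
digit d t j = ℤ.∣ floor ((+ d ℚ./ 1) ℚ.* σ^ d j t) ∣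

-- inverse of p modulo q: least k < q with p k ≡ 1 (mod q)  (0 if none)
private
  search : ℕ → ℕ → ℕ → ℕ → ℕ
  search p q zero    k = 0
  search p q (suc f) k with (p ℕ.* k) % suc q ℕ.≟ 1
  ... | yes _ = k
  ... | no  _ = search p q f (suc k)

inv : ℕ → ℕ → ℕ
inv p zero    = 0
inv p (suc q) = search p q (suc q) 0

-- Representative sequence of the orbit whose least element is t
-- (t = 0.\overline{a_0 … a_{q-1}}, indices mod q):
-- k-th term is a_{k p*} if k ≤ q-p-1, and a_{k p*} - 1 if k ≥ q-p.
RepSeq : ℕ → ℕ → (q : ℕ) → ℚ → Fin q → ℕ
RepSeq d p (suc q) t k =
  if toℕ k ℕ.+ p ℕ.<ᵇ suc q
    then a
    else a ∸ 1
  where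
    a : ℕ
    a = digit d t ((toℕ k ℕ.* inv p (suc q)) % suc q)

IsSeq : ℕ → List ℕ → Set
IsSeq r xs = Sorted ≤-totalOrder xs × All (ℕ._< r) xs

-- the sequences s_i (i : Fin n, each of length q) can be interlaced as
-- (d-1)-sequences: for some relabeling π, the sequence
-- b_0^{(π1)},…,b_0^{(πn)},b_1^{(π1)},…,b_{q-1}^{(πn)} is a (d-1)-sequence
CanInterlace : ℕ → (q n : ℕ) → (Fin n → Fin q → ℕ) → Set
CanInterlace d q n s =
  Σ (Permutation′ n) λ π → IsSeq (d ∸ 1)
    (concat (map (λ k → map (λ i → s (π ⟨$⟩ʳ i) k) (allFin n)) (allFin q)))

module Submission where

-- Listed increasingly from its least point t, a rotational orbit is shifted by p places under σ,
-- so its point in place k is σ^(k p*) t and the representative sequence records the first digits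
-- of these points, lowered by one in the p places where σ wraps around.
--
-- If the union is rotational, its points come in q blocks, block k holding the points in place k
-- of the distinct orbits. Reading them increasingly reads the representative sequences
-- interlaced: digits grow with the point, and across the wrap they grow strictly, which absorbs
-- the −1.
--
-- Conversely, an interlacing lists all points of the union with nondecreasing first digits. A
-- descent in this list has equal digits at its ends, so σ maps it to another descent with the
-- gap multiplied by d; as σ permutes the places with period q, the list is sorted. Deleting
-- repeated points (from coinciding orbits) leaves a sorted list on which σ is the rotation p/q.

open import Defs
open import Data.Nat as ℕ using (ℕ; zero; suc; _+_; _*_; _%_; _/_; _∸_; _≤_; _<_; _≟_; _<ᵇ_; z≤n; s≤s; NonZero; 2+)
import Data.Nat.Properties as ℕP
open import Data.Nat.DivMod
import Data.Nat.Divisibility as Divisibility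
import Data.Nat.Coprimality as Coprimality
open import Data.Nat.GCD using (gcd; gcd-GCD; GCD; module Bézout)
open import Data.Nat.Solver renaming (module +-*-Solver to ℕ-Solver)
open import Data.Integer as ℤ using (ℤ)
import Data.Integer.Properties as ℤP
import Data.Integer.DivMod as ℤD
open import Data.Rational as ℚ using (ℚ; mkℚ; floor; 0ℚ; 1ℚ)
import Data.Rational.Properties as ℚP
import Data.Rational.Unnormalised as ℚᵘ
import Data.Rational.Unnormalised.Properties as ℚᵘP
open import Data.Rational.Solver renaming (module +-*-Solver to ℚ-Solver)
open import Data.Fin as Fin using (Fin; toℕ; fromℕ<; _↑ˡ_; _↑ʳ_; quotient; remainder)
import Data.Fin.Properties as FinP
open import Data.Fin.Permutation using (Permutation′; _⟨$⟩ʳ_; _⟨$⟩ˡ_; inverseʳ; lift₀; transpose; _∘ₚ_; id)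
import Data.Fin.Permutation.Components as PermutationComponents
open import Data.List using (_∷_; _++_; map; concat; tabulate; allFin)
import Data.List.Properties as ListP
import Data.List.Relation.Unary.All.Properties as AllP
open import Data.List.Relation.Unary.AllPairs using (AllPairs; _∷_)
import Data.List.Relation.Unary.AllPairs.Properties as AllPairsP
open import Data.List.Relation.Unary.Sorted.TotalOrder using (Sorted)
import Data.List.Relation.Unary.Sorted.TotalOrder.Properties as SortedP
open import Data.Bool using (true; false; if_then_else_; T)
open import Data.Bool.Properties using (T-≡)
open import Data.Product as Product using (Σ; _×_; _,_; proj₁; proj₂; ∃-syntax)
open import Data.Sum as Sum using (inj₁; inj₂; _⊎_; [_,_]′)
open import Data.Empty using (⊥-elim)
open import Function using (_∘_; case_of_)
open import Function.Bundles using (_⇔_; Equivalence; mk⇔)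
open import Relation.Nullary using (Dec; yes; no; does)
open import Relation.Nullary.Decidable using (dec-true; dec-false)
open import Relation.Binary.Definitions using (tri<; tri≈; tri>)
open import Relation.Binary.PropositionalEquality

fromℤ : ℤ → ℚ
fromℤ z = z ℚ./ 1

fromℕ : ℕ → ℚ
fromℕ n = fromℤ (ℤ.+ n)

toℚᵘ-fromℤ : ∀ z → ℚ.toℚᵘ (fromℤ z) ℚᵘ.≃ ℚᵘ.mkℚᵘ z 0
toℚᵘ-fromℤ z = ℚP.toℚᵘ-fromℚᵘ (ℚᵘ.mkℚᵘ z 0)

fromℤ-+ : ∀ a b → fromℤ (a ℤ.+ b) ≡ fromℤ a ℚ.+ fromℤ b
fromℤ-+ a b = ℚP.toℚᵘ-injective (ℚᵘP.≃-trans (toℚᵘ-fromℤ (a ℤ.+ b)) (ℚᵘP.≃-trans unnormalised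
  (ℚᵘP.≃-sym (ℚᵘP.≃-trans (ℚP.toℚᵘ-homo-+ (fromℤ a) (fromℤ b)) (ℚᵘP.+-cong (toℚᵘ-fromℤ a) (toℚᵘ-fromℤ b))))))
  where
  unnormalised : ℚᵘ.mkℚᵘ (a ℤ.+ b) 0 ℚᵘ.≃ ℚᵘ.mkℚᵘ a 0 ℚᵘ.+ ℚᵘ.mkℚᵘ b 0
  unnormalised = ℚᵘ.*≡* (cong (ℤ._* ℤ.+ 1) (cong₂ ℤ._+_ (sym (ℤP.*-identityʳ a)) (sym (ℤP.*-identityʳ b))))

fromℤ-mono-≤ : ∀ {a b} → a ℤ.≤ b → fromℤ a ℚ.≤ fromℤ b
fromℤ-mono-≤ {a} {b} a≤b = ℚP.toℚᵘ-cancel-≤ (ℚᵘP.≤-respʳ-≃ (ℚᵘP.≃-sym (toℚᵘ-fromℤ b))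
  (ℚᵘP.≤-respˡ-≃ (ℚᵘP.≃-sym (toℚᵘ-fromℤ a))
    (ℚᵘ.*≤* (subst₂ ℤ._≤_ (sym (ℤP.*-identityʳ a)) (sym (ℤP.*-identityʳ b)) a≤b))))

fromℤ-mono-< : ∀ {a b} → a ℤ.< b → fromℤ a ℚ.< fromℤ b
fromℤ-mono-< {a} {b} a<b = ℚP.toℚᵘ-cancel-< (ℚᵘP.<-respʳ-≃ (ℚᵘP.≃-sym (toℚᵘ-fromℤ b))
  (ℚᵘP.<-respˡ-≃ (ℚᵘP.≃-sym (toℚᵘ-fromℤ a))
    (ℚᵘ.*<* (subst₂ ℤ._<_ (sym (ℤP.*-identityʳ a)) (sym (ℤP.*-identityʳ b)) a<b))))

fromℕ-suc : ∀ a → fromℕ (suc a) ≡ fromℕ a ℚ.+ 1ℚ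
fromℕ-suc a = trans (cong fromℤ (ℤP.+-comm (ℤ.+ 1) (ℤ.+ a))) (fromℤ-+ (ℤ.+ a) (ℤ.+ 1))

fromℕ-mono-≤ : ∀ {a b} → a ℕ.≤ b → fromℕ a ℚ.≤ fromℕ b
fromℕ-mono-≤ a≤b = fromℤ-mono-≤ (ℤ.+≤+ a≤b)

fromℕ-mono-< : ∀ {a b} → a ℕ.< b → fromℕ a ℚ.< fromℕ b
fromℕ-mono-< a<b = fromℤ-mono-< (ℤ.+<+ a<b)

fromℤ-floor-≤ : ∀ x → fromℤ (floor x) ℚ.≤ x
fromℤ-floor-≤ x@(mkℚ n k _) = ℚP.toℚᵘ-cancel-≤
  (ℚᵘP.≤-respˡ-≃ (ℚᵘP.≃-sym (toℚᵘ-fromℤ (floor x))) (ℚᵘ.*≤* (subst₂ ℤ._≤_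
    (cong (ℤ._* ℤ.+ suc k) (sym (ℤD.div-pos-is-/ℕ n (suc k)))) (sym (ℤP.*-identityʳ n))
    (ℤD.[n/ℕd]*d≤n n (suc k)))))

<-fromℤ-floor+1 : ∀ x → x ℚ.< fromℤ (floor x ℤ.+ ℤ.+ 1)
<-fromℤ-floor+1 x@(mkℚ n k _) = ℚP.toℚᵘ-cancel-<
  (ℚᵘP.<-respʳ-≃ (ℚᵘP.≃-sym (toℚᵘ-fromℤ (floor x ℤ.+ ℤ.+ 1))) (ℚᵘ.*<* (subst₂ ℤ._<_
    (sym (ℤP.*-identityʳ n))
    (cong (ℤ._* ℤ.+ suc k) (trans (ℤP.+-comm (ℤ.+ 1) (n ℤ./ℕ suc k))
      (cong (ℤ._+ ℤ.+ 1) (sym (ℤD.div-pos-is-/ℕ n (suc k))))))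
    (ℤD.n<s[n/ℕd]*d n (suc k)))))

fromℕ-∣floor∣ : ∀ x → 0ℚ ℚ.≤ x → fromℕ ℤ.∣ floor x ∣ ≡ fromℤ (floor x)
fromℕ-∣floor∣ (mkℚ (ℤ.+ n) k _) _ =
  trans (cong (λ z → fromℕ ℤ.∣ z ∣) floor≡) (cong fromℤ (sym floor≡))
  where floor≡ = ℤD.div-pos-is-/ℕ (ℤ.+ n) (suc k)
fromℕ-∣floor∣ (mkℚ ℤ.-[1+ n ] k _) (ℚ.*≤* ())

module _ where
  open ℚ-Solver

  floor+frac : ∀ x → x ≡ fromℤ (floor x) ℚ.+ frac x
  floor+frac x = solve 2 (λ x a → x := a :+ (x :- a)) refl x (fromℤ (floor x))

  frac-nonNeg : ∀ x → 0ℚ ℚ.≤ frac x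
  frac-nonNeg x = subst (ℚ._≤ frac x) (ℚP.+-inverseʳ (fromℤ (floor x)))
    (ℚP.+-monoˡ-≤ (ℚ.- fromℤ (floor x)) (fromℤ-floor-≤ x))

  frac<1 : ∀ x → frac x ℚ.< 1ℚ
  frac<1 x = subst (frac x ℚ.<_) (solve 1 (λ a → (a :+ con 1ℚ) :- a := con 1ℚ) refl (fromℤ (floor x)))
    (ℚP.+-monoˡ-< (ℚ.- fromℤ (floor x)) (subst (x ℚ.<_) (fromℤ-+ (floor x) (ℤ.+ 1)) (<-fromℤ-floor+1 x)))

  +-cancelˡ-< : ∀ a {b c} → a ℚ.+ b ℚ.< a ℚ.+ c → b ℚ.< c
  +-cancelˡ-< a {b} {c} a+b<a+c = subst₂ ℚ._<_ (cancel b) (cancel c) (ℚP.+-monoʳ-< (ℚ.- a) a+b<a+c)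
    where
    cancel : ∀ z → ℚ.- a ℚ.+ (a ℚ.+ z) ≡ z
    cancel z = solve 2 (λ a z → (:- a) :+ (a :+ z) := z) refl a z

  x<y⇒0<y-x : ∀ {x y} → x ℚ.< y → 0ℚ ℚ.< y ℚ.- x
  x<y⇒0<y-x {x} {y} x<y = subst (ℚ._< y ℚ.- x) (ℚP.+-inverseʳ x) (ℚP.+-monoˡ-< (ℚ.- x) x<y)

÷-toℚᵘ : ∀ a b → ℚ.toℚᵘ (a ÷ suc b) ℚᵘ.≃ ℚᵘ.mkℚᵘ (ℤ.+ a) b
÷-toℚᵘ a b = ℚP.toℚᵘ-fromℚᵘ (ℚᵘ.mkℚᵘ (ℤ.+ a) b)

÷-≡⇒*-≡ : ∀ a b c e → a ÷ suc b ≡ c ÷ suc e → a ℕ.* suc e ≡ c ℕ.* suc b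
÷-≡⇒*-≡ a b c e h with ℚᵘP.≃-trans (ℚᵘP.≃-sym (÷-toℚᵘ a b)) (ℚᵘP.≃-trans (ℚP.toℚᵘ-cong h) (÷-toℚᵘ c e))
... | ℚᵘ.*≡* eq = ℤP.+-injective (trans (ℤP.pos-* a (suc e)) (trans eq (sym (ℤP.pos-* c (suc b)))))

*-≡⇒÷-≡ : ∀ a b c e → a ℕ.* suc e ≡ c ℕ.* suc b → a ÷ suc b ≡ c ÷ suc e
*-≡⇒÷-≡ a b c e h = ℚP.toℚᵘ-injective (ℚᵘP.≃-trans (÷-toℚᵘ a b) (ℚᵘP.≃-trans
  (ℚᵘ.*≡* (trans (sym (ℤP.pos-* a (suc e))) (trans (cong ℤ.+_ h) (ℤP.pos-* c (suc b)))))
  (ℚᵘP.≃-sym (÷-toℚᵘ c e))))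

≤∧≢⇒< : ∀ {x y : ℚ} → x ℚ.≤ y → x ≢ y → x ℚ.< y
≤∧≢⇒< {x} {y} x≤y x≢y with ℚP.<-cmp x y
... | tri< x<y _ _ = x<y
... | tri≈ _ x≡y _ = ⊥-elim (x≢y x≡y)
... | tri> _ _ y<x = ⊥-elim (ℚP.<-irrefl refl (ℚP.<-≤-trans y<x x≤y))

module Digits (d : ℕ) (2≤d : 2 ≤ d) where

  open ℚ-Solver

  d̂ : ℚ
  d̂ = fromℕ d

  instance
    d̂-positive : ℚ.Positive d̂
    d̂-positive = ℚ.positive (fromℕ-mono-< (ℕP.<-≤-trans (s≤s z≤n) 2≤d))

  dig : ℚ → ℕ
  dig x = ℤ.∣ floor (d̂ ℚ.* x) ∣

  d̂*-nonNeg : ∀ {x} → 0ℚ ℚ.≤ x → 0ℚ ℚ.≤ d̂ ℚ.* x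
  d̂*-nonNeg {x} 0≤x = subst (ℚ._≤ d̂ ℚ.* x) (ℚP.*-zeroʳ d̂) (ℚP.*-monoˡ-≤-nonNeg d̂ {{ℚP.pos⇒nonNeg d̂}} 0≤x)

  d̂*≡dig+σ : ∀ {x} → 0ℚ ℚ.≤ x → d̂ ℚ.* x ≡ fromℕ (dig x) ℚ.+ σ d x
  d̂*≡dig+σ {x} 0≤x = trans (floor+frac (d̂ ℚ.* x)) (cong (ℚ._+ σ d x) (sym (fromℕ-∣floor∣ (d̂ ℚ.* x) (d̂*-nonNeg 0≤x))))

  σ-In𝕋 : ∀ x → In𝕋 (σ d x)
  σ-In𝕋 x = frac-nonNeg (d̂ ℚ.* x) , frac<1 (d̂ ℚ.* x)

  σ^-In𝕋 : ∀ {t} k → In𝕋 t → In𝕋 (σ^ d k t)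
  σ^-In𝕋 zero    t∈𝕋 = t∈𝕋
  σ^-In𝕋 (suc k) _   = σ-In𝕋 _

  dig≤d̂* : ∀ {x} → 0ℚ ℚ.≤ x → fromℕ (dig x) ℚ.≤ d̂ ℚ.* x
  dig≤d̂* {x} 0≤x = subst (fromℕ (dig x) ℚ.≤_) (sym (d̂*≡dig+σ 0≤x))
    (subst (ℚ._≤ fromℕ (dig x) ℚ.+ σ d x) (ℚP.+-identityʳ (fromℕ (dig x)))
      (ℚP.+-monoʳ-≤ (fromℕ (dig x)) (frac-nonNeg (d̂ ℚ.* x))))

  d̂*<dig+1 : ∀ {x} → 0ℚ ℚ.≤ x → d̂ ℚ.* x ℚ.< fromℕ (suc (dig x))
  d̂*<dig+1 {x} 0≤x = subst₂ ℚ._<_ (sym (d̂*≡dig+σ 0≤x)) (sym (fromℕ-suc (dig x)))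
    (ℚP.+-monoʳ-< (fromℕ (dig x)) (frac<1 (d̂ ℚ.* x)))

  dig-mono-≤ : ∀ {x y} → 0ℚ ℚ.≤ x → 0ℚ ℚ.≤ y → x ℚ.≤ y → dig x ≤ dig y
  dig-mono-≤ {x} {y} 0≤x 0≤y x≤y = ℕP.≮⇒≥ λ dig-y<dig-x → ℚP.<-irrefl refl (begin-strict
    d̂ ℚ.* y               <⟨ d̂*<dig+1 0≤y ⟩
    fromℕ (suc (dig y))   ≤⟨ fromℕ-mono-≤ dig-y<dig-x ⟩
    fromℕ (dig x)         ≤⟨ dig≤d̂* 0≤x ⟩
    d̂ ℚ.* x               ≤⟨ ℚP.*-monoˡ-≤-nonNeg d̂ {{ℚP.pos⇒nonNeg d̂}} x≤y ⟩
    d̂ ℚ.* y               ∎)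
    where open ℚP.≤-Reasoning

  dig<d : ∀ {x} → In𝕋 x → dig x < d
  dig<d {x} (0≤x , x<1) = ℕP.≰⇒> λ d≤dig → ℚP.<-irrefl refl (begin-strict
    d̂ ℚ.* x          <⟨ ℚP.*-monoʳ-<-pos d̂ x<1 ⟩
    d̂ ℚ.* 1ℚ         ≡⟨ ℚP.*-identityʳ d̂ ⟩
    d̂                ≤⟨ fromℕ-mono-≤ d≤dig ⟩
    fromℕ (dig x)    ≤⟨ dig≤d̂* 0≤x ⟩
    d̂ ℚ.* x          ∎)
    where open ℚP.≤-Reasoning

  σ≡d̂*-dig : ∀ {x} → 0ℚ ℚ.≤ x → σ d x ≡ d̂ ℚ.* x ℚ.- fromℕ (dig x)
  σ≡d̂*-dig {x} 0≤x = trans (solve 2 (λ a s → s := (a :+ s) :- a) refl (fromℕ (dig x)) (σ d x))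
    (cong (ℚ._- fromℕ (dig x)) (sym (d̂*≡dig+σ 0≤x)))

  σ-sameDigit : ∀ {x y} → 0ℚ ℚ.≤ x → 0ℚ ℚ.≤ y → dig x ≡ dig y → σ d y ℚ.- σ d x ≡ d̂ ℚ.* (y ℚ.- x)
  σ-sameDigit {x} {y} 0≤x 0≤y same = trans
    (cong₂ ℚ._-_ (σ≡d̂*-dig 0≤y) (trans (σ≡d̂*-dig 0≤x) (cong (λ a → d̂ ℚ.* x ℚ.- fromℕ a) same)))
    (solve 4 (λ a x y d → (d :* y :- a) :- (d :* x :- a) := d :* (y :- x)) refl (fromℕ (dig y)) x y d̂)

  σ-mono-sameDigit : ∀ {x y} → 0ℚ ℚ.≤ x → 0ℚ ℚ.≤ y → dig x ≡ dig y → x ℚ.< y → σ d x ℚ.< σ d y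
  σ-mono-sameDigit {x} {y} 0≤x 0≤y same x<y = +-cancelˡ-< (fromℕ (dig x))
    (subst₂ ℚ._<_ (d̂*≡dig+σ 0≤x) (trans (d̂*≡dig+σ 0≤y) (cong (λ a → fromℕ a ℚ.+ σ d y) (sym same)))
      (ℚP.*-monoʳ-<-pos d̂ x<y))

  σ-expands-sameDigit : ∀ {x y} → 0ℚ ℚ.≤ x → 0ℚ ℚ.≤ y → dig x ≡ dig y → x ℚ.< y → y ℚ.- x ℚ.< σ d y ℚ.- σ d x
  σ-expands-sameDigit {x} {y} 0≤x 0≤y same x<y = subst₂ ℚ._<_ (ℚP.+-identityʳ (y ℚ.- x)) y-x+[d̂-1][y-x]≡
    (ℚP.+-monoʳ-< (y ℚ.- x) (subst (ℚ._< (d̂ ℚ.- 1ℚ) ℚ.* (y ℚ.- x)) (ℚP.*-zeroʳ (d̂ ℚ.- 1ℚ))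
      (ℚP.*-monoʳ-<-pos (d̂ ℚ.- 1ℚ) {{ℚ.positive (x<y⇒0<y-x (fromℕ-mono-< 2≤d))}} (x<y⇒0<y-x x<y))))
    where
    y-x+[d̂-1][y-x]≡ : (y ℚ.- x) ℚ.+ (d̂ ℚ.- 1ℚ) ℚ.* (y ℚ.- x) ≡ σ d y ℚ.- σ d x
    y-x+[d̂-1][y-x]≡ = trans (solve 2 (λ g d → g :+ (d :- con 1ℚ) :* g := d :* g) refl (y ℚ.- x) d̂)
      (sym (σ-sameDigit 0≤x 0≤y same))

  Orbit-In𝕋 : ∀ {t x} → In𝕋 t → Orbit d t x → In𝕋 x
  Orbit-In𝕋 t∈𝕋 (k , refl) = σ^-In𝕋 k t∈𝕋

  σ^-+ : ∀ l k t → σ^ d l (σ^ d k t) ≡ σ^ d (l + k) t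
  σ^-+ zero    k t = refl
  σ^-+ (suc l) k t = cong (σ d) (σ^-+ l k t)

  Orbit-trans : ∀ {t x y} → Orbit d t x → Orbit d x y → Orbit d t y
  Orbit-trans {t} (k , refl) (l , refl) = l + k , sym (σ^-+ l k t)

open ℕ-Solver

[m%n+o]%n≡[m+o]%n : ∀ m o n .{{_ : NonZero n}} → (m % n + o) % n ≡ (m + o) % n
[m%n+o]%n≡[m+o]%n m o n = begin
  (m % n + o) % n             ≡⟨ %-distribˡ-+ (m % n) o n ⟩
  (m % n % n + o % n) % n     ≡⟨ cong (λ x → (x + o % n) % n) (m%n%n≡m%n m n) ⟩
  (m % n + o % n) % n         ≡⟨ %-distribˡ-+ m o n ⟨
  (m + o) % n                 ∎
  where open ≡-Reasoning

[m+o%n]%n≡[m+o]%n : ∀ m o n .{{_ : NonZero n}} → (m + o % n) % n ≡ (m + o) % n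
[m+o%n]%n≡[m+o]%n m o n = trans (cong (_% n) (ℕP.+-comm m (o % n)))
  (trans ([m%n+o]%n≡[m+o]%n o m n) (cong (_% n) (ℕP.+-comm o m)))

[m%n*o]%n≡[m*o]%n : ∀ m o n .{{_ : NonZero n}} → (m % n * o) % n ≡ (m * o) % n
[m%n*o]%n≡[m*o]%n m o n = begin
  (m % n * o) % n             ≡⟨ %-distribˡ-* (m % n) o n ⟩
  (m % n % n * (o % n)) % n   ≡⟨ cong (λ x → (x * (o % n)) % n) (m%n%n≡m%n m n) ⟩
  (m % n * (o % n)) % n       ≡⟨ %-distribˡ-* m o n ⟨
  (m * o) % n                 ∎
  where open ≡-Reasoning

[m*[o%n]]%n≡[m*o]%n : ∀ m o n .{{_ : NonZero n}} → (m * (o % n)) % n ≡ (m * o) % n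
[m*[o%n]]%n≡[m*o]%n m o n = trans (cong (_% n) (ℕP.*-comm m (o % n)))
  (trans ([m%n*o]%n≡[m*o]%n o m n) (cong (_% n) (ℕP.*-comm o m)))

m≡m%n+n*[m/n] : ∀ m n .{{_ : NonZero n}} → m ≡ m % n + n * (m / n)
m≡m%n+n*[m/n] m n = trans (m≡m%n+[m/n]*n m n) (cong (m % n +_) (ℕP.*-comm (m / n) n))

[r+n*k]%n≡r : ∀ r k n .{{_ : NonZero n}} → r < n → (r + n * k) % n ≡ r
[r+n*k]%n≡r r k n r<n = trans (cong (λ x → (r + x) % n) (ℕP.*-comm n k)) (trans ([m+kn]%n≡m%n r k n) (m<n⇒m%n≡m r<n))

[r+n*k]/n≡k : ∀ r k n .{{_ : NonZero n}} → r < n → (r + n * k) / n ≡ k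
[r+n*k]/n≡k r k n r<n = begin
  (r + n * k) / n      ≡⟨ cong (λ x → (r + x) / n) (ℕP.*-comm n k) ⟩
  (r + k * n) / n      ≡⟨ +-distrib-/-∣ʳ r (Divisibility.divides-refl k) ⟩
  r / n + k * n / n    ≡⟨ cong₂ _+_ (m<n⇒m/n≡0 r<n) (m*n/n≡m k n) ⟩
  k                    ∎
  where open ≡-Reasoning

r+n*k<n*q : ∀ {r k n q} → r < n → k < q → r + n * k < n * q
r+n*k<n*q {r} {k} {n} {q} r<n k<q = begin-strict
  r + n * k    <⟨ ℕP.+-monoˡ-< (n * k) r<n ⟩
  n + n * k    ≡⟨ ℕP.*-suc n k ⟨
  n * suc k    ≤⟨ ℕP.*-monoʳ-≤ n k<q ⟩
  n * q        ∎
  where open ℕP.≤-Reasoning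

[r+n*k]%[n*q]≡r+n*[k%q] : ∀ r k n q .{{_ : NonZero q}} .{{_ : NonZero (n * q)}} → r < n →
                          (r + n * k) % (n * q) ≡ r + n * (k % q)
[r+n*k]%[n*q]≡r+n*[k%q] r k n q r<n = begin
  (r + n * k) % (n * q)                            ≡⟨ cong (λ x → (r + n * x) % (n * q)) (m≡m%n+[m/n]*n k q) ⟩
  (r + n * (k % q + k / q * q)) % (n * q)          ≡⟨ cong (_% (n * q)) (solve 5 (λ r n a b q → r :+ n :* (a :+ b :* q) :=
                                                        (r :+ n :* a) :+ b :* (n :* q)) refl r n (k % q) (k / q) q) ⟩
  (r + n * (k % q) + k / q * (n * q)) % (n * q)    ≡⟨ [m+kn]%n≡m%n (r + n * (k % q)) (k / q) (n * q) ⟩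
  (r + n * (k % q)) % (n * q)                      ≡⟨ m<n⇒m%n≡m (r+n*k<n*q r<n (m%n<n k q)) ⟩
  r + n * (k % q)                                  ∎
  where open ≡-Reasoning

r+n*k<r′+n*k′⇒ : ∀ {n r k r′ k′} → r < n → r′ < n → r + n * k < r′ + n * k′ → k < k′ ⊎ (k ≡ k′ × r < r′)
r+n*k<r′+n*k′⇒ {n} {r} {k} {r′} {k′} r<n r′<n lt with ℕP.<-cmp k k′
... | tri< k<k′ _ _ = inj₁ k<k′
... | tri≈ _ refl _ = inj₂ (refl , ℕP.+-cancelʳ-< (n * k) r r′ lt)
... | tri> _ _ k′<k = ⊥-elim (ℕP.<-asym lt (begin-strict
  r′ + n * k′  <⟨ r+n*k<n*q r′<n (ℕP.n<1+n k′) ⟩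
  n * suc k′   ≤⟨ ℕP.*-monoʳ-≤ n k′<k ⟩
  n * k        ≤⟨ ℕP.m≤n+m (n * k) r ⟩
  r + n * k    ∎))
  where open ℕP.≤-Reasoning

m%n≡m∸n : ∀ m n .{{_ : NonZero n}} → n ≤ m → m < n + n → m % n ≡ m ∸ n
m%n≡m∸n m n n≤m m<n+n = trans (sym (m≤n⇒[n∸m]%m≡n%m n≤m))
  (m<n⇒m%n≡m (ℕP.+-cancelʳ-< n (m ∸ n) n (subst (_< n + n) (sym (ℕP.m∸n+n≡m n≤m)) m<n+n)))

coprime-proportional : ∀ {P m p q} .{{_ : NonZero q}} → gcd p q ≡ 1 → P * q ≡ p * m → ∃[ g ] (m ≡ g * q × P ≡ g * p)
coprime-proportional {P} {m} {p} {q} gcd≡1 P*q≡p*m = g , m≡g*q , P≡g*p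
  where
  q∣m = Coprimality.coprime-divisor {q} {p} (Coprimality.sym (Coprimality.gcd≡1⇒coprime gcd≡1)) (Divisibility.divides P (sym P*q≡p*m))
  g = Divisibility.quotient q∣m
  m≡g*q = Divisibility.m∣n⇒n≡quotient*m q∣m
  P≡g*p = ℕP.*-cancelʳ-≡ P (g * p) q (trans P*q≡p*m (trans (cong (p *_) m≡g*q) (solve 3 (λ p g q → p :* (g :* q) := g :* p :* q) refl p g q)))

lex⇒r+n*k≤r′+n*k′ : ∀ {n r k r′ k′} → r < n → k < k′ ⊎ (k ≡ k′ × r ≤ r′) → r + n * k ≤ r′ + n * k′
lex⇒r+n*k≤r′+n*k′ {n} {r} {k} {r′} {k′} r<n (inj₁ k<k′) = begin
  r + n * k     ≤⟨ ℕP.<⇒≤ (r+n*k<n*q r<n (ℕP.n<1+n k)) ⟩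
  n * suc k     ≤⟨ ℕP.*-monoʳ-≤ n k<k′ ⟩
  n * k′        ≤⟨ ℕP.m≤n+m (n * k′) r′ ⟩
  r′ + n * k′   ∎
  where open ℕP.≤-Reasoning
lex⇒r+n*k≤r′+n*k′ {n} {k = k} _ (inj₂ (refl , r≤r′)) = ℕP.+-monoˡ-≤ (n * k) r≤r′

[r+n*k+n*p]%[n*q]≡r+n*[[k+p]%q] : ∀ r k p n q .{{_ : NonZero q}} .{{_ : NonZero (n * q)}} → r < n →
                                  (r + n * k + n * p) % (n * q) ≡ r + n * ((k + p) % q)
[r+n*k+n*p]%[n*q]≡r+n*[[k+p]%q] r k p n q r<n = trans
  (cong (_% (n * q)) (solve 4 (λ r n k p → r :+ n :* k :+ n :* p := r :+ n :* (k :+ p)) refl r n k p))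
  ([r+n*k]%[n*q]≡r+n*[k%q] r (k + p) n q r<n)

IsInverseMod : ℕ → ℕ → ℕ → Set
IsInverseMod q p x = (p * x) % suc q ≡ 1

mutual
  searchInverse : (p q fuel k : ℕ) → ℕ
  searchInverse p q zero       k = 0
  searchInverse p q (suc fuel) k = searchInverseStep p q fuel k ((p * k) % suc q ≟ 1)

  searchInverseStep : (p q fuel k : ℕ) → Dec (IsInverseMod q p k) → ℕ
  searchInverseStep p q fuel k (yes _) = k
  searchInverseStep p q fuel k (no _)  = searchInverse p q fuel (suc k)

searchInverse-correct : ∀ p q fuel k {j} → k ≤ j → j < k + fuel → IsInverseMod q p j →
                        IsInverseMod q p (searchInverse p q fuel k)
searchInverse-correct p q zero k {j} k≤j j<k+0 _ = ⊥-elim (ℕP.<⇒≱ (subst (j <_) (ℕP.+-identityʳ k) j<k+0) k≤j)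
searchInverse-correct p q (suc fuel) k {j} k≤j j<k+fuel inv-j with (p * k) % suc q ≟ 1
... | yes inv-k = inv-k
... | no ¬inv-k with ℕP.m≤n⇒m<n∨m≡n k≤j
...   | inj₂ refl = ⊥-elim (¬inv-k inv-j)
...   | inj₁ k<j = searchInverse-correct p q fuel (suc k) k<j (subst (j <_) (ℕP.+-suc k fuel) j<k+fuel) inv-j

searchInverseStep-unique : ∀ p q (step : (fuel k : ℕ) → Dec (IsInverseMod q p k) → ℕ) →
  (∀ fuel k a → step fuel k (yes a) ≡ k) →
  (∀ k ¬a → step zero k (no ¬a) ≡ 0) →
  (∀ fuel k ¬a → step (suc fuel) k (no ¬a) ≡ step fuel (suc k) ((p * suc k) % suc q ≟ 1)) →
  ∀ fuel k d → step fuel k d ≡ searchInverseStep p q fuel k d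
searchInverseStep-unique p q step step-yes step-zero step-suc = go
  where
  go : ∀ fuel k d → step fuel k d ≡ searchInverseStep p q fuel k d
  go fuel       k (yes a)  = step-yes fuel k a
  go zero       k (no ¬a)  = step-zero k ¬a
  go (suc fuel) k (no ¬a)  = trans (step-suc fuel k ¬a) (go fuel (suc k) _)

-- `inv` is computed by the private `search` of Defs. Once all its arguments are variables,
-- unification solves `definedSearchStep` with the with-function of `search`.
mutual
  definedSearchStep : (p q fuel k : ℕ) → Dec (IsInverseMod q p k) → ℕ
  definedSearchStep = _

  inv≡searchInverse : ∀ p q → inv p (2+ q) ≡ searchInverse p (suc q) (2+ q) 0
  inv≡searchInverse p zero with (p * 0) % 2 ≟ 1
  ... | yes _ = refl
  ... | no _ with (p * 1) % 2 ≟ 1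
  ...   | yes _ = refl
  ...   | no _ = refl
  inv≡searchInverse p (suc r) with (p * 0) % suc (2+ r) ≟ 1
  ... | yes _ = refl
  ... | no _ with (p * 1) % suc (2+ r) ≟ 1
  ...   | yes _ = refl
  ...   | no _ with 2+ r | 2 | (p * 2) % suc (2+ r) ≟ 1
  ...     | Q | k | d = searchInverseStep-unique p Q (definedSearchStep p Q)
                          (λ _ _ _ → refl) (λ _ _ → refl) (λ _ _ _ → refl) r k d

inverse-exists : ∀ p q → gcd p (2+ q) ≡ 1 → ∃[ x ] IsInverseMod (suc q) p x
inverse-exists p q gcd≡1 with Bézout.identity (subst (GCD p (2+ q)) gcd≡1 (gcd-GCD p (2+ q)))
... | Bézout.+- x y 1+yQ≡xp = x , (begin
  (p * x) % Q           ≡⟨ cong (_% Q) (trans (ℕP.*-comm p x) (sym 1+yQ≡xp)) ⟩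
  (1 + y * Q) % Q       ≡⟨ [m+kn]%n≡m%n 1 y Q ⟩
  1                     ∎)
  where open ≡-Reasoning
        Q = 2+ q
... | Bézout.-+ x y 1+xp≡yQ = x * q′ , (begin
  (p * (x * q′)) % Q                 ≡⟨ [m+n]%n≡m%n (p * (x * q′)) Q ⟨
  (p * (x * q′) + Q) % Q             ≡⟨ cong (_% Q) (solve 3 (λ p x q → p :* (x :* q) :+ (con 1 :+ q) :=
                                                         con 1 :+ (con 1 :+ x :* p) :* q) refl p x q′) ⟩
  (1 + (1 + x * p) * q′) % Q         ≡⟨ cong (λ z → (1 + z * q′) % Q) 1+xp≡yQ ⟩
  (1 + y * Q * q′) % Q               ≡⟨ cong (λ z → (1 + z) % Q) (solve 3 (λ y Q q → y :* Q :* q := y :* q :* Q) refl y Q q′) ⟩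
  (1 + y * q′ * Q) % Q               ≡⟨ [m+kn]%n≡m%n 1 (y * q′) Q ⟩
  1                                  ∎)
  where open ≡-Reasoning
        Q = 2+ q
        q′ = suc q

inv-correct : ∀ p q → gcd p (2+ q) ≡ 1 → (p * inv p (2+ q)) % 2+ q ≡ 1
inv-correct p q gcd≡1 with inverse-exists p q gcd≡1
... | x , inv-x = subst (IsInverseMod (suc q) p) (sym (inv≡searchInverse p q))
  (searchInverse-correct p (suc q) (2+ q) 0 z≤n (m%n<n x (2+ q)) (trans ([m*[o%n]]%n≡[m*o]%n p x (2+ q)) inv-x))

tabulate-++ : ∀ {A : Set} a b (f : Fin (a + b) → A) → tabulate f ≡ tabulate (f ∘ (_↑ˡ b)) ++ tabulate (f ∘ (a ↑ʳ_))
tabulate-++ zero b f = refl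
tabulate-++ (suc a) b f = cong (f Fin.zero ∷_) (tabulate-++ a b (f ∘ Fin.suc))

concat-tabulate-tabulate : ∀ {A : Set} q n (G : Fin q → Fin n → A) →
  concat (tabulate (tabulate ∘ G)) ≡ tabulate {n = q * n} (λ x → G (quotient n x) (remainder {q} n x))
concat-tabulate-tabulate zero n G = refl
concat-tabulate-tabulate (suc q) n G = trans (cong (tabulate (G Fin.zero) ++_) (concat-tabulate-tabulate q n (G ∘ Fin.suc)))
  (sym (trans (tabulate-++ n (q * n) _) (cong₂ _++_ (ListP.tabulate-cong first-block) (ListP.tabulate-cong later-blocks))))
  where
  first-block : ∀ i → G (quotient {suc q} n (i ↑ˡ q * n)) (remainder {suc q} n (i ↑ˡ q * n)) ≡ G Fin.zero i
  first-block i rewrite FinP.splitAt-↑ˡ n i (q * n) = refl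
  later-blocks : ∀ j → G (quotient {suc q} n (n ↑ʳ j)) (remainder {suc q} n (n ↑ʳ j)) ≡ G (Fin.suc (quotient n j)) (remainder {q} n j)
  later-blocks j rewrite FinP.splitAt-↑ʳ n (q * n) j = refl

concat-map-map-allFin : ∀ {A : Set} q n (G : Fin q → Fin n → A) →
  concat (map (λ k → map (λ i → G k i) (allFin n)) (allFin q)) ≡ tabulate {n = q * n} (λ x → G (quotient n x) (remainder {q} n x))
concat-map-map-allFin q n G = trans
  (cong concat (trans (ListP.map-tabulate (λ k → k) _) (ListP.tabulate-cong (λ k → ListP.map-tabulate (λ i → i) (G k)))))
  (concat-tabulate-tabulate q n G)

toℕ-remainder+quotient : ∀ q n (x : Fin (q * n)) → toℕ x ≡ toℕ (remainder {q} n x) + n * toℕ (quotient {q} n x)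
toℕ-remainder+quotient q n x = trans (cong toℕ (sym (FinP.combine-remQuot {q} n x)))
  (trans (FinP.toℕ-combine (quotient {q} n x) (remainder {q} n x)) (ℕP.+-comm (n * toℕ (quotient {q} n x)) _))

Sorted-tabulate⁺ : ∀ {N} (h : Fin N → ℕ) → (∀ x y → toℕ x < toℕ y → h x ≤ h y) → Sorted ℕP.≤-totalOrder (tabulate h)
Sorted-tabulate⁺ h mono = SortedP.AllPairs⇒Sorted ℕP.≤-totalOrder (AllPairsP.tabulate⁺-< (mono _ _))

Sorted-tabulate⁻ : ∀ {N} (h : Fin N → ℕ) → Sorted ℕP.≤-totalOrder (tabulate h) → ∀ x y → toℕ x < toℕ y → h x ≤ h y
Sorted-tabulate⁻ h sorted = AllPairs-tabulate⁻ h (SortedP.Sorted⇒AllPairs ℕP.≤-totalOrder sorted)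
  where
  AllPairs-tabulate⁻ : ∀ {N} (h : Fin N → ℕ) → AllPairs _≤_ (tabulate h) → ∀ x y → toℕ x < toℕ y → h x ≤ h y
  AllPairs-tabulate⁻ h (first ∷ _) Fin.zero (Fin.suc y) _ = AllP.tabulate⁻ first y
  AllPairs-tabulate⁻ h (_ ∷ rest) (Fin.suc x) (Fin.suc y) (s≤s x<y) = AllPairs-tabulate⁻ (h ∘ Fin.suc) rest x y x<y

argmin : ∀ n (c : Fin (suc n) → ℕ) → ∃[ i ] (∀ j → c i ≤ c j)
argmin zero c = Fin.zero , λ { Fin.zero → ℕP.≤-refl }
argmin (suc n) c with argmin n (c ∘ Fin.suc)
... | i , min with ℕP.≤-total (c Fin.zero) (c (Fin.suc i))
...   | inj₁ c₀≤ = Fin.zero , λ { Fin.zero → ℕP.≤-refl ; (Fin.suc j) → ℕP.≤-trans c₀≤ (min j) }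
...   | inj₂ ≤c₀ = Fin.suc i , λ { Fin.zero → ≤c₀ ; (Fin.suc j) → min j }

sortingPermutation : ∀ n (c : Fin n → ℕ) → Σ (Permutation′ n) λ π → ∀ i j → i Fin.≤ j → c (π ⟨$⟩ʳ i) ≤ c (π ⟨$⟩ʳ j)
sortingPermutation zero c = id , λ ()
sortingPermutation (suc n) c = lift₀ (proj₁ rest) ∘ₚ transpose Fin.zero i₀ , sorted
  where
  i₀ = proj₁ (argmin n c)
  rest = sortingPermutation n (c ∘ PermutationComponents.transpose Fin.zero i₀ ∘ Fin.suc)
  sorted : ∀ i j → i Fin.≤ j → _
  sorted Fin.zero j _ = proj₂ (argmin n c) _
  sorted (Fin.suc i) (Fin.suc j) (s≤s i≤j) = proj₂ rest i j i≤j

interlaced : ∀ {q n} (s : Fin n → Fin q → ℕ) → Permutation′ n → Fin (q * n) → ℕ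
interlaced {q} {n} s π x = s (π ⟨$⟩ʳ remainder {q} n x) (quotient n x)

module _ (d q n : ℕ) (s : Fin n → Fin q → ℕ) where

  private
    concat≡tabulate : ∀ π → concat (map (λ k → map (λ i → s (π ⟨$⟩ʳ i) k) (allFin n)) (allFin q)) ≡ tabulate (interlaced s π)
    concat≡tabulate π = concat-map-map-allFin q n (λ k i → s (π ⟨$⟩ʳ i) k)

  sorted⇒CanInterlace : ∀ π → (∀ x y → toℕ x < toℕ y → interlaced s π x ≤ interlaced s π y) →
                        (∀ x → interlaced s π x < d ∸ 1) → CanInterlace d q n s
  sorted⇒CanInterlace π sorted bounded =
    π , subst (IsSeq (d ∸ 1)) (sym (concat≡tabulate π)) (Sorted-tabulate⁺ (interlaced s π) sorted , AllP.tabulate⁺ bounded)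

  CanInterlace⇒sorted : CanInterlace d q n s → Σ (Permutation′ n) λ π → ∀ x y → toℕ x < toℕ y → interlaced s π x ≤ interlaced s π y
  CanInterlace⇒sorted (π , sorted , _) = π , Sorted-tabulate⁻ (interlaced s π) (subst (Sorted ℕP.≤-totalOrder) (concat≡tabulate π) sorted)

if-<ᵇ-< : ∀ {A : Set} {m n} {a b : A} → m < n → (if m <ᵇ n then a else b) ≡ a
if-<ᵇ-< {m = m} {n} {a} {b} m<n = cong (if_then a else b) (Equivalence.to T-≡ (ℕP.<⇒<ᵇ m<n))

if-<ᵇ-≥ : ∀ {A : Set} {m n} {a b : A} → n ≤ m → (if m <ᵇ n then a else b) ≡ b
if-<ᵇ-≥ {m = m} {n} {a} {b} n≤m with m <ᵇ n in eq
... | false = refl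
... | true  = ⊥-elim (ℕP.<⇒≱ (ℕP.<ᵇ⇒< m n (subst T (sym eq) _)) n≤m)

module Rotation (d p q₀ : ℕ) (2≤d : 2 ≤ d) (1≤p : 1 ≤ p) (p<q : p < 2+ q₀) (gcd≡1 : gcd p (2+ q₀) ≡ 1) where

  open Digits d 2≤d public

  q : ℕ
  q = 2+ q₀

  p* : ℕ
  p* = inv p q

  [[k*p*]%q*p]%q≡k%q : ∀ k → ((k * p*) % q * p) % q ≡ k % q
  [[k*p*]%q*p]%q≡k%q k = begin
    ((k * p*) % q * p) % q   ≡⟨ [m%n*o]%n≡[m*o]%n (k * p*) p q ⟩
    (k * p* * p) % q         ≡⟨ cong (_% q) (solve 3 (λ k i p → k :* i :* p := k :* (p :* i)) refl k p* p) ⟩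
    (k * (p * p*)) % q       ≡⟨ [m*[o%n]]%n≡[m*o]%n k (p * p*) q ⟨
    (k * ((p * p*) % q)) % q ≡⟨ cong (λ z → (k * z) % q) (inv-correct p q₀ gcd≡1) ⟩
    (k * 1) % q              ≡⟨ cong (_% q) (ℕP.*-identityʳ k) ⟩
    k % q                    ∎
    where open ≡-Reasoning

  returnSteps : ℕ → ℕ
  returnSteps k = ((q ∸ k) * p*) % q

  [k+returnSteps[k]*p]%q≡0 : ∀ {k} → k ≤ q → (k + returnSteps k * p) % q ≡ 0
  [k+returnSteps[k]*p]%q≡0 {k} k≤q = begin
    (k + returnSteps k * p) % q               ≡⟨ [m+o%n]%n≡[m+o]%n k (returnSteps k * p) q ⟨
    (k + (returnSteps k * p) % q) % q         ≡⟨ cong (λ z → (k + z) % q) ([[k*p*]%q*p]%q≡k%q (q ∸ k)) ⟩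
    (k + (q ∸ k) % q) % q                     ≡⟨ [m+o%n]%n≡[m+o]%n k (q ∸ k) q ⟩
    (k + (q ∸ k)) % q                         ≡⟨ cong (_% q) (ℕP.m+[n∸m]≡n k≤q) ⟩
    q % q                                     ≡⟨ n%n≡0 q ⟩
    0                                         ∎
    where open ≡-Reasoning

  lastNoWrap : ℕ
  lastNoWrap = suc q₀ ∸ p

  lastNoWrap+p≡q-1 : lastNoWrap + p ≡ suc q₀
  lastNoWrap+p≡q-1 = ℕP.m∸n+n≡m (ℕP.≤-pred p<q)

  1+lastNoWrap<q : suc lastNoWrap < q
  1+lastNoWrap<q = s≤s (subst (suc lastNoWrap ≤_) lastNoWrap+p≡q-1
    (subst (_≤ lastNoWrap + p) (ℕP.+-comm lastNoWrap 1) (ℕP.+-monoʳ-≤ lastNoWrap 1≤p)))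

  lastNoWrap<q : lastNoWrap < q
  lastNoWrap<q = ℕP.<-trans (ℕP.n<1+n lastNoWrap) 1+lastNoWrap<q

  no-wrap⇒≤lastNoWrap : ∀ {k} → k + p < q → k ≤ lastNoWrap
  no-wrap⇒≤lastNoWrap {k} no-wrap = ℕP.+-cancelʳ-≤ p k lastNoWrap (subst (k + p ≤_) (sym lastNoWrap+p≡q-1) (ℕP.≤-pred no-wrap))

  wrap⇒lastNoWrap< : ∀ {k} → q ≤ k + p → lastNoWrap < k
  wrap⇒lastNoWrap< {k} wrap = ℕP.+-cancelʳ-≤ p (suc lastNoWrap) k (subst (_≤ k + p) (sym (cong suc lastNoWrap+p≡q-1)) wrap)

  q≤q-1+p : q ≤ suc q₀ + p
  q≤q-1+p = subst (_≤ suc q₀ + p) (ℕP.+-comm (suc q₀) 1) (ℕP.+-monoʳ-≤ (suc q₀) 1≤p)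

-- For a rotational orbit listed increasingly from its least point t, σ adds p to the place,
-- so this is the point in place k. `RepSeq d p q t k` unfolds to `repEntry (cyclicPoint t (toℕ k)) (toℕ k)`.
  cyclicPoint : ℚ → ℕ → ℚ
  cyclicPoint t k = σ^ d ((k * p*) % q) t

  repEntry : ℚ → ℕ → ℕ
  repEntry x k = if k + p <ᵇ q then dig x else dig x ∸ 1

  carry : ℕ → ℕ
  carry k = if k + p <ᵇ q then 0 else 1

  dig≡repEntry+carry : ∀ x k → (q ≤ k + p → 1 ≤ dig x) → dig x ≡ repEntry x k + carry k
  dig≡repEntry+carry x k wrap⇒1≤dig with ℕP.<-≤-connex (k + p) q
  ... | inj₁ no-wrap = sym (trans (cong₂ _+_ (if-<ᵇ-< no-wrap) (if-<ᵇ-< no-wrap)) (ℕP.+-identityʳ (dig x)))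
  ... | inj₂ wrap = sym (trans (cong₂ _+_ (if-<ᵇ-≥ wrap) (if-<ᵇ-≥ wrap))
                               (trans (ℕP.+-comm (dig x ∸ 1) 1) (ℕP.m+[n∸m]≡n (wrap⇒1≤dig wrap))))

  carry-mono : ∀ {k k′} → k ≤ k′ → carry k ≤ carry k′
  carry-mono {k} {k′} k≤k′ with ℕP.<-≤-connex (k + p) q | ℕP.<-≤-connex (k′ + p) q
  ... | inj₁ no-wrap | _ = subst (_≤ carry k′) (sym (if-<ᵇ-< no-wrap)) z≤n
  ... | inj₂ wrap | inj₂ wrap′ = ℕP.≤-reflexive (trans (if-<ᵇ-≥ wrap) (sym (if-<ᵇ-≥ wrap′)))
  ... | inj₂ wrap | inj₁ no-wrap′ = ⊥-elim (ℕP.<⇒≱ no-wrap′ (ℕP.≤-trans wrap (ℕP.+-monoˡ-≤ p k≤k′)))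

-- A rotational set with rotation number p/q, listed increasingly: g·q points on which σ adds g·p
-- to the index; point (r + g * k), k < q, runs through the orbit of point r.
  record Enumeration (S : ℚ → Set) : Set where
    field
      g′    : ℕ
      point : ℕ → ℚ
    g : ℕ
    g = suc g′
    size : ℕ
    size = g * q
    field
      point-< : ∀ {i j} → i < j → j < size → point i ℚ.< point j
      point-σ : ∀ {j} → j < size → σ d (point j) ≡ point ((j + g * p) % size)
      point-∈ : ∀ {j} → j < size → S (point j)
      ∈⇒point : ∀ {x} → S x → ∃[ j ] (j < size × point j ≡ x)

  fromProportional : ∀ {S} g′ (t : Fin (suc g′ * q) → ℚ) → (∀ i j → i Fin.< j → t i ℚ.< t j) →
                (∀ x → S x ⇔ (∃[ i ] t i ≡ x)) →
                (p′ : Fin (suc g′ * q)) → toℕ p′ ≡ suc g′ * p → (∀ i → σ d (t i) ≡ t (i +ₘ p′)) → Enumeration S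
  fromProportional {S} g′ t t-< S⇔ p′ p′≡g*p t-σ = record
    { g′ = g′ ; point = point ; point-< = point-< ; point-σ = point-σ ; point-∈ = point-∈ ; ∈⇒point = ∈⇒point }
    where
    M = suc g′ * q
    index : ℕ → Fin M
    index j = fromℕ< (m%n<n j M)
    toℕ-index : ∀ {j} → j < M → toℕ (index j) ≡ j
    toℕ-index {j} j<M = trans (FinP.toℕ-fromℕ< _) (m<n⇒m%n≡m j<M)
    point : ℕ → ℚ
    point j = t (index j)
    point-< : ∀ {i j} → i < j → j < M → point i ℚ.< point j
    point-< {i} {j} i<j j<M = t-< _ _ (subst₂ _<_ (sym (toℕ-index (ℕP.<-trans i<j j<M))) (sym (toℕ-index j<M)) i<j)
    point-σ : ∀ {j} → j < M → σ d (point j) ≡ point ((j + suc g′ * p) % M)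
    point-σ {j} j<M = trans (t-σ (index j)) (cong t (FinP.toℕ-injective (begin
      toℕ (index j +ₘ p′)                      ≡⟨ FinP.toℕ-fromℕ< _ ⟩
      (toℕ (index j) + toℕ p′) % M             ≡⟨ cong₂ (λ a b → (a + b) % M) (toℕ-index j<M) p′≡g*p ⟩
      (j + suc g′ * p) % M                     ≡⟨ toℕ-index (m%n<n (j + suc g′ * p) M) ⟨
      toℕ (index ((j + suc g′ * p) % M))       ∎)))
      where open ≡-Reasoning
    point-∈ : ∀ {j} → j < M → S (point j)
    point-∈ {j} _ = Equivalence.from (S⇔ (point j)) (index j , refl)
    ∈⇒point : ∀ {x} → S x → ∃[ j ] (j < M × point j ≡ x)
    ∈⇒point {x} x∈S with Equivalence.to (S⇔ x) x∈S
    ... | i , tᵢ≡x = toℕ i , FinP.toℕ<n i , trans (cong t (FinP.toℕ-injective (toℕ-index (FinP.toℕ<n i)))) tᵢ≡x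

  Rotational⇒Enumeration : ∀ {S} → Rotational d S (p ÷ q) → Enumeration S
  Rotational⇒Enumeration (zero , _ , _ , _ , () , _)
  Rotational⇒Enumeration (suc m′ , t , t-< , S⇔ , p′ , _ , t-σ , p′/m≡p/q) =
    proportional t t-< S⇔ p′ t-σ (coprime-proportional gcd≡1 (÷-≡⇒*-≡ (toℕ p′) m′ p (suc q₀) p′/m≡p/q))
    where
    proportional : ∀ {S m} (t : Fin m → ℚ) → (∀ i j → i Fin.< j → t i ℚ.< t j) → (∀ x → S x ⇔ (∃[ i ] t i ≡ x)) →
                   (p′ : Fin m) → (∀ i → σ d (t i) ≡ t (i +ₘ p′)) → ∃[ g ] (m ≡ g * q × toℕ p′ ≡ g * p) → Enumeration S
    proportional t t-< S⇔ p′ t-σ (suc g′ , refl , p′≡g*p) = fromProportional g′ t t-< S⇔ p′ p′≡g*p t-σ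

  Enumeration⇒Rotational : ∀ {S} → Enumeration S → Rotational d S (p ÷ q)
  Enumeration⇒Rotational {S} E = size , t , t-< , S⇔ , p′ , toℕp′≢0 , t-σ , p′/size≡p/q
    where
    open Enumeration E
    t : Fin size → ℚ
    t i = point (toℕ i)
    t-< : ∀ i j → i Fin.< j → t i ℚ.< t j
    t-< i j i<j = point-< i<j (FinP.toℕ<n j)
    S⇔ : ∀ x → S x ⇔ (∃[ i ] t i ≡ x)
    S⇔ x = mk⇔ (λ x∈S → let (j , j<size , pⱼ≡x) = ∈⇒point x∈S in fromℕ< j<size , trans (cong point (FinP.toℕ-fromℕ< j<size)) pⱼ≡x)
               (λ { (i , tᵢ≡x) → subst S tᵢ≡x (point-∈ (FinP.toℕ<n i)) })
    g*p<size : g * p < size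
    g*p<size = ℕP.*-monoʳ-< g p<q
    p′ : Fin size
    p′ = fromℕ< g*p<size
    toℕp′≢0 : toℕ p′ ≢ 0
    toℕp′≢0 toℕp′≡0 = ℕP.<⇒≢ (ℕP.<-≤-trans 1≤p (ℕP.m≤m+n p (g′ * p)))
      (sym (trans (sym (FinP.toℕ-fromℕ< g*p<size)) toℕp′≡0))
    t-σ : ∀ i → σ d (t i) ≡ t (i +ₘ p′)
    t-σ i = trans (point-σ (FinP.toℕ<n i)) (cong point (sym (trans (FinP.toℕ-fromℕ< _)
      (cong (λ z → (toℕ i + z) % size) (FinP.toℕ-fromℕ< g*p<size)))))
    p′/size≡p/q : toℕ p′ ÷ size ≡ p ÷ q
    p′/size≡p/q = subst (λ z → z ÷ size ≡ p ÷ q) (sym (FinP.toℕ-fromℕ< g*p<size))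
      (*-≡⇒÷-≡ (g * p) _ p (suc q₀) (solve 3 (λ g p q → g :* p :* q := p :* (g :* q)) refl g p q))


  module Enumerated {S : ℚ → Set} (E : Enumeration S)
                    (point-In𝕋 : ∀ {j} → j < Enumeration.size E → In𝕋 (Enumeration.point E j)) where

    open Enumeration E public

    point-≤ : ∀ {i j} → i ≤ j → j < size → point i ℚ.≤ point j
    point-≤ i≤j j<size with ℕP.m≤n⇒m<n∨m≡n i≤j
    ... | inj₁ i<j  = ℚP.<⇒≤ (point-< i<j j<size)
    ... | inj₂ refl = ℚP.≤-refl

    dig-point-mono : ∀ {i j} → i ≤ j → j < size → dig (point i) ≤ dig (point j)
    dig-point-mono i≤j j<size =
      dig-mono-≤ (proj₁ (point-In𝕋 (ℕP.≤-<-trans i≤j j<size))) (proj₁ (point-In𝕋 j<size)) (point-≤ i≤j j<size)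

    σ^-point : ∀ {c} l → c < size → σ^ d l (point c) ≡ point ((c + l * (g * p)) % size)
    σ^-point {c} zero c<size = cong point (sym (trans (cong (_% size) (ℕP.+-identityʳ c)) (m<n⇒m%n≡m c<size)))
    σ^-point {c} (suc l) c<size = trans (cong (σ d) (σ^-point l c<size)) (trans (point-σ (m%n<n (c + l * (g * p)) size))
      (cong point (trans ([m%n+o]%n≡[m+o]%n (c + l * (g * p)) (g * p) size)
        (cong (_% size) (solve 3 (λ c l x → c :+ l :* x :+ x := c :+ (x :+ l :* x)) refl c l (g * p))))))

    σ^-point-block : ∀ {r k} l → r < g → k < q → σ^ d l (point (r + g * k)) ≡ point (r + g * ((k + l * p) % q))
    σ^-point-block {r} {k} l r<g k<q = trans (σ^-point l (r+n*k<n*q r<g k<q)) (cong point (trans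
      (cong (_% size) (solve 5 (λ r g k l p → r :+ g :* k :+ l :* (g :* p) := r :+ g :* (k :+ l :* p)) refl r g k l p))
      ([r+n*k]%[n*q]≡r+n*[k%q] r (k + l * p) g q r<g)))

    σ-point-block : ∀ {r k} → r < g → k < q → σ d (point (r + g * k)) ≡ point (r + g * ((k + p) % q))
    σ-point-block {r} {k} r<g k<q =
      trans (σ^-point-block 1 r<g k<q) (cong (λ z → point (r + g * ((k + z) % q))) (ℕP.+-identityʳ p))

    cyclicPoint-point : ∀ {r k} → r < g → k < q → cyclicPoint (point r) k ≡ point (r + g * k)
    cyclicPoint-point {r} {k} r<g k<q = begin
      σ^ d ((k * p*) % q) (point r)                        ≡⟨ cong (λ i → σ^ d ((k * p*) % q) (point i)) r≡r+g*0 ⟩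
      σ^ d ((k * p*) % q) (point (r + g * 0))              ≡⟨ σ^-point-block ((k * p*) % q) r<g (s≤s z≤n) ⟩
      point (r + g * (((k * p*) % q * p) % q))             ≡⟨ cong (λ i → point (r + g * i)) (trans ([[k*p*]%q*p]%q≡k%q k) (m<n⇒m%n≡m k<q)) ⟩
      point (r + g * k)                                    ∎
      where
      open ≡-Reasoning
      r≡r+g*0 : r ≡ r + g * 0
      r≡r+g*0 = sym (trans (cong (r +_) (ℕP.*-zeroʳ g)) (ℕP.+-identityʳ r))

-- σ maps these two neighbouring points to the largest and the smallest point, so it does not
-- preserve their order; hence their digits differ.
    dig-at-wrap : dig (point (g′ + g * lastNoWrap)) < dig (point (g * suc lastNoWrap))
    dig-at-wrap = ℕP.≤∧≢⇒< (dig-point-mono (ℕP.<⇒≤ a<w) w<size) λ same → ℚP.<-asym bottom<top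
      (subst₂ ℚ._<_ σa≡top σw≡bottom
        (σ-mono-sameDigit (proj₁ (point-In𝕋 a<size)) (proj₁ (point-In𝕋 w<size)) same (point-< a<w w<size)))
      where
      a w top : ℕ
      a = g′ + g * lastNoWrap
      w = g * suc lastNoWrap
      top = g′ + g * suc q₀
      a<size : a < size
      a<size = r+n*k<n*q (ℕP.n<1+n g′) lastNoWrap<q
      w<size : w < size
      w<size = ℕP.*-monoʳ-< g 1+lastNoWrap<q
      a<w : a < w
      a<w = subst (a <_) (sym (ℕP.*-suc g lastNoWrap)) (ℕP.n<1+n a)
      σa≡top : σ d (point a) ≡ point top
      σa≡top = trans (σ-point-block (ℕP.n<1+n g′) lastNoWrap<q)
        (cong (λ i → point (g′ + g * i)) (trans (cong (_% q) lastNoWrap+p≡q-1) (m<n⇒m%n≡m (ℕP.n<1+n (suc q₀)))))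
      σw≡bottom : σ d (point w) ≡ point 0
      σw≡bottom = trans (σ-point-block (s≤s z≤n) 1+lastNoWrap<q)
        (trans (cong (λ i → point (g * i)) (trans (cong (_% q) (cong suc lastNoWrap+p≡q-1)) (n%n≡0 q)))
               (cong point (ℕP.*-zeroʳ g)))
      bottom<top : point 0 ℚ.< point top
      bottom<top = point-< (ℕP.<-≤-trans (s≤s z≤n) (ℕP.m≤n+m (g * suc q₀) g′)) (r+n*k<n*q (ℕP.n<1+n g′) (ℕP.n<1+n (suc q₀)))

    dig-across-wrap : ∀ {r r′ k k′} → r < g → r′ < g → k + p < q → q ≤ k′ + p → k′ < q →
                      dig (point (r + g * k)) < dig (point (r′ + g * k′))
    dig-across-wrap {r} {r′} {k} {k′} r<g r′<g no-wrap wrap k′<q = begin-strict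
      dig (point (r + g * k))                 ≤⟨ dig-point-mono (ℕP.+-mono-≤ (ℕP.≤-pred r<g) (ℕP.*-monoʳ-≤ g (no-wrap⇒≤lastNoWrap no-wrap)))
                                                                  (r+n*k<n*q (ℕP.n<1+n g′) lastNoWrap<q) ⟩
      dig (point (g′ + g * lastNoWrap))       <⟨ dig-at-wrap ⟩
      dig (point (g * suc lastNoWrap))        ≤⟨ dig-point-mono (ℕP.≤-trans (ℕP.*-monoʳ-≤ g (wrap⇒lastNoWrap< wrap)) (ℕP.m≤n+m (g * k′) r′))
                                                                  (r+n*k<n*q r′<g k′<q) ⟩
      dig (point (r′ + g * k′))               ∎
      where open ℕP.≤-Reasoning

    1≤dig-point-wrap : ∀ {r k} → r < g → k < q → q ≤ k + p → 1 ≤ dig (point (r + g * k))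
    1≤dig-point-wrap r<g k<q wrap = ℕP.≤-<-trans z≤n (dig-across-wrap (s≤s z≤n) r<g p<q wrap k<q)

    repEntry-point-mono : ∀ {r r′ k k′} → r < g → r′ < g → k′ < q → k ≤ k′ → r + g * k ≤ r′ + g * k′ →
                          repEntry (point (r + g * k)) k ≤ repEntry (point (r′ + g * k′)) k′
    repEntry-point-mono {r} {r′} {k} {k′} r<g r′<g k′<q k≤k′ i≤i′
      with ℕP.<-≤-connex (k + p) q | ℕP.<-≤-connex (k′ + p) q
    ... | inj₁ no-wrap | inj₁ no-wrap′ = subst₂ _≤_ (sym (if-<ᵇ-< no-wrap)) (sym (if-<ᵇ-< no-wrap′))
            (dig-point-mono i≤i′ (r+n*k<n*q r′<g k′<q))
    ... | inj₁ no-wrap | inj₂ wrap′ = subst₂ _≤_ (sym (if-<ᵇ-< no-wrap)) (sym (if-<ᵇ-≥ wrap′))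
            (ℕP.<⇒≤pred (dig-across-wrap r<g r′<g no-wrap wrap′ k′<q))
    ... | inj₂ wrap | inj₁ no-wrap′ = ⊥-elim (ℕP.<⇒≱ no-wrap′ (ℕP.≤-trans wrap (ℕP.+-monoˡ-≤ p k≤k′)))
    ... | inj₂ wrap | inj₂ wrap′ = subst₂ _≤_ (sym (if-<ᵇ-≥ wrap)) (sym (if-<ᵇ-≥ wrap′))
            (ℕP.∸-monoˡ-≤ 1 (dig-point-mono i≤i′ (r+n*k<n*q r′<g k′<q)))

    repEntry-point<d∸1 : ∀ {r k} → r < g → k < q → repEntry (point (r + g * k)) k < d ∸ 1
    repEntry-point<d∸1 {r} {k} r<g k<q with ℕP.<-≤-connex (k + p) q
    ... | inj₁ no-wrap = subst (_< d ∸ 1) (sym (if-<ᵇ-< no-wrap)) (ℕP.<-≤-trans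
            (dig-across-wrap r<g (ℕP.n<1+n g′) no-wrap q≤q-1+p (ℕP.n<1+n (suc q₀)))
            (ℕP.<⇒≤pred (dig<d (point-In𝕋 (r+n*k<n*q (ℕP.n<1+n g′) (ℕP.n<1+n (suc q₀)))))))
    ... | inj₂ wrap = subst (_< d ∸ 1) (sym (if-<ᵇ-≥ wrap))
            (ℕP.∸-monoˡ-< (dig<d (point-In𝕋 (r+n*k<n*q r<g k<q))) (1≤dig-point-wrap r<g k<q wrap))

    least⇒index : ∀ {t} → S t → (∀ x → Orbit d t x → t ℚ.≤ x) → ∃[ c ] (c < g × point c ≡ t)
    least⇒index {t} t∈S least = c , ℕP.≤-<-trans c≤r (m%n<n c g) , pc≡t
      where
      c = proj₁ (∈⇒point t∈S)
      c<size = proj₁ (proj₂ (∈⇒point t∈S))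
      pc≡t = proj₂ (proj₂ (∈⇒point t∈S))
      r = c % g
      k = c / g
      k<q : k < q
      k<q = m<n*o⇒m/o<n (subst (c <_) (ℕP.*-comm g q) c<size)
      t-reaches-r : σ^ d (returnSteps k) t ≡ point r
      t-reaches-r = begin
        σ^ d (returnSteps k) t                            ≡⟨ cong (σ^ d (returnSteps k)) (trans (sym pc≡t) (cong point (m≡m%n+n*[m/n] c g))) ⟩
        σ^ d (returnSteps k) (point (r + g * k))          ≡⟨ σ^-point-block (returnSteps k) (m%n<n c g) k<q ⟩
        point (r + g * ((k + returnSteps k * p) % q))    ≡⟨ cong (λ i → point (r + g * i)) ([k+returnSteps[k]*p]%q≡0 (ℕP.<⇒≤ k<q)) ⟩
        point (r + g * 0)                                 ≡⟨ cong point (trans (cong (r +_) (ℕP.*-zeroʳ g)) (ℕP.+-identityʳ r)) ⟩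
        point r                                           ∎
        where open ≡-Reasoning
      c≤r : c ≤ r
      c≤r = ℕP.≮⇒≥ λ r<c → ℚP.<-irrefl refl
        (ℚP.≤-<-trans (least (point r) (returnSteps k , t-reaches-r)) (subst (point r ℚ.<_) pc≡t (point-< r<c c<size)))

  module RotationalOrbit {t} (t∈𝕋 : In𝕋 t) (rot : Rotational d (Orbit d t) (p ÷ q)) (least : IsLeast (Orbit d t) t) where

    private
      E = Rotational⇒Enumeration rot
      open Enumerated E (λ j<size → Orbit-In𝕋 t∈𝕋 (Enumeration.point-∈ E j<size))
      c = proj₁ (least⇒index (proj₁ least) (proj₂ least))
      c<g = proj₁ (proj₂ (least⇒index (proj₁ least) (proj₂ least)))
      pc≡t = proj₂ (proj₂ (least⇒index (proj₁ least) (proj₂ least)))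

      cyclicPoint≡point : ∀ {k} → k < q → cyclicPoint t k ≡ point (c + g * k)
      cyclicPoint≡point {k} k<q = trans (cong (λ x → cyclicPoint x k) (sym pc≡t)) (cyclicPoint-point c<g k<q)

    cyclicPoint-< : ∀ {k k′} → k < k′ → k′ < q → cyclicPoint t k ℚ.< cyclicPoint t k′
    cyclicPoint-< k<k′ k′<q = subst₂ ℚ._<_ (sym (cyclicPoint≡point (ℕP.<-trans k<k′ k′<q))) (sym (cyclicPoint≡point k′<q))
      (point-< (ℕP.+-monoʳ-< c (ℕP.*-monoʳ-< g k<k′)) (r+n*k<n*q c<g k′<q))

    σ^-cyclicPoint : ∀ {k} l → k < q → σ^ d l (cyclicPoint t k) ≡ cyclicPoint t ((k + l * p) % q)
    σ^-cyclicPoint {k} l k<q = trans (cong (σ^ d l) (cyclicPoint≡point k<q))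
      (trans (σ^-point-block l c<g k<q) (sym (cyclicPoint≡point (m%n<n (k + l * p) q))))

    σ-cyclicPoint : ∀ {k} → k < q → σ d (cyclicPoint t k) ≡ cyclicPoint t ((k + p) % q)
    σ-cyclicPoint {k} k<q = trans (σ^-cyclicPoint 1 k<q) (cong (λ z → cyclicPoint t ((k + z) % q)) (ℕP.+-identityʳ p))

    orbit⇒cyclicPoint : ∀ {x} → Orbit d t x → ∃[ k ] (k < q × cyclicPoint t k ≡ x)
    orbit⇒cyclicPoint (l , refl) = (l * p) % q , m%n<n (l * p) q , sym (σ^-cyclicPoint l (s≤s z≤n))

    t∈orbit-cyclicPoint : ∀ {k} → k < q → Orbit d (cyclicPoint t k) t
    t∈orbit-cyclicPoint {k} k<q = returnSteps k ,
      trans (σ^-cyclicPoint (returnSteps k) k<q) (cong (cyclicPoint t) ([k+returnSteps[k]*p]%q≡0 (ℕP.<⇒≤ k<q)))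

    dig-cyclicPoint : ∀ {k} → k < q → dig (cyclicPoint t k) ≡ repEntry (cyclicPoint t k) k + carry k
    dig-cyclicPoint {k} k<q = dig≡repEntry+carry (cyclicPoint t k) k
      (λ wrap → subst (λ x → 1 ≤ dig x) (sym (cyclicPoint≡point k<q)) (1≤dig-point-wrap c<g k<q wrap))

  Union : ∀ {n} → (Fin n → ℚ) → ℚ → Set
  Union t x = ∃[ i ] Orbit d (t i) x

  module Forward {n} (t : Fin n → ℚ) (t∈𝕋 : ∀ i → In𝕋 (t i)) (least : ∀ i → IsLeast (Orbit d (t i)) (t i))
                 (E : Enumeration (Union t)) where

    open Enumerated E (λ j<size → Orbit-In𝕋 (t∈𝕋 (proj₁ (Enumeration.point-∈ E j<size))) (proj₂ (Enumeration.point-∈ E j<size)))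

    leastIndex : ∀ i → ∃[ c ] (c < g × point c ≡ t i)
    leastIndex i = least⇒index (i , 0 , refl) (proj₂ (least i))

    index : Fin n → ℕ
    index i = proj₁ (leastIndex i)

    index<g : ∀ i → index i < g
    index<g i = proj₁ (proj₂ (leastIndex i))

    RepSeq≡repEntry-point : ∀ i (k : Fin q) → RepSeq d p q (t i) k ≡ repEntry (point (index i + g * toℕ k)) (toℕ k)
    RepSeq≡repEntry-point i k = cong (λ x → repEntry x (toℕ k))
      (trans (cong (λ x → cyclicPoint x (toℕ k)) (sym (proj₂ (proj₂ (leastIndex i)))))
             (cyclicPoint-point (index<g i) (FinP.toℕ<n k)))

    π = proj₁ (sortingPermutation n index)

    interlaced-sorted : ∀ x y → toℕ x < toℕ y → interlaced (λ i → RepSeq d p q (t i)) π x ≤ interlaced (λ i → RepSeq d p q (t i)) π y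
    interlaced-sorted x y x<y = subst₂ _≤_ (sym (RepSeq≡repEntry-point _ k)) (sym (RepSeq≡repEntry-point _ k′))
      (repEntry-point-mono (index<g _) (index<g _) (FinP.toℕ<n k′) k≤k′ (lex⇒r+n*k≤r′+n*k′ (index<g _) index-lex))
      where
      k = quotient {q} n x
      k′ = quotient {q} n y
      r = remainder {q} n x
      r′ = remainder {q} n y
      lex : toℕ k < toℕ k′ ⊎ (toℕ k ≡ toℕ k′ × toℕ r < toℕ r′)
      lex = r+n*k<r′+n*k′⇒ (FinP.toℕ<n r) (FinP.toℕ<n r′) (subst₂ _<_ (toℕ-remainder+quotient q n x) (toℕ-remainder+quotient q n y) x<y)
      k≤k′ : toℕ k ≤ toℕ k′
      k≤k′ = [ ℕP.<⇒≤ , ℕP.≤-reflexive ∘ proj₁ ]′ lex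
      index-lex : toℕ k < toℕ k′ ⊎ (toℕ k ≡ toℕ k′ × index (π ⟨$⟩ʳ r) ≤ index (π ⟨$⟩ʳ r′))
      index-lex = Sum.map₂ (Product.map₂ (proj₂ (sortingPermutation n index) r r′ ∘ ℕP.<⇒≤)) lex

    interlaced-bounded : ∀ x → interlaced (λ i → RepSeq d p q (t i)) π x < d ∸ 1
    interlaced-bounded x = subst (_< d ∸ 1) (sym (RepSeq≡repEntry-point _ (quotient n x)))
      (repEntry-point<d∸1 (index<g _) (FinP.toℕ<n (quotient {q} n x)))

    canInterlace : CanInterlace d q n (λ i → RepSeq d p q (t i))
    canInterlace = sorted⇒CanInterlace d q n (λ i → RepSeq d p q (t i)) π interlaced-sorted interlaced-bounded

  module Backward (n₀ : ℕ) (t : Fin (suc n₀) → ℚ) (t∈𝕋 : ∀ i → In𝕋 (t i))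
                  (rot : ∀ i → Rotational d (Orbit d (t i)) (p ÷ q)) (least : ∀ i → IsLeast (Orbit d (t i)) (t i))
                  (π : Permutation′ (suc n₀))
                  (sorted : ∀ x y → toℕ x < toℕ y → interlaced (λ i → RepSeq d p q (t i)) π x ≤ interlaced (λ i → RepSeq d p q (t i)) π y)
                  where

    module OrbitOf i = RotationalOrbit (t∈𝕋 i) (rot i) (least i)

    n N : ℕ
    n = suc n₀
    N = n * q

    residue : ℕ → Fin n
    residue j = fromℕ< (m%n<n j n)

    slot : ℕ → Fin n
    slot j = π ⟨$⟩ʳ residue j

-- For j = r + n * k, the point in place k of the orbit in slot r: the j-th term of the interlacing.
    U : ℕ → ℚ
    U j = cyclicPoint (t (slot j)) (j / n)

    U-In𝕋 : ∀ j → In𝕋 (U j)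
    U-In𝕋 j = σ^-In𝕋 ((j / n * p*) % q) (t∈𝕋 (slot j))

    j/n<q : ∀ {j} → j < N → j / n < q
    j/n<q {j} j<N = m<n*o⇒m/o<n (subst (j <_) (ℕP.*-comm n q) j<N)

    residue-block : ∀ {r} k → r < n → residue (r + n * k) ≡ residue r
    residue-block {r} k r<n = FinP.toℕ-injective (trans (FinP.toℕ-fromℕ< _)
      (trans ([r+n*k]%n≡r r k n r<n) (sym (trans (FinP.toℕ-fromℕ< _) (m<n⇒m%n≡m r<n)))))

    residue-mod : ∀ j → residue (j % n) ≡ residue j
    residue-mod j = FinP.toℕ-injective (trans (FinP.toℕ-fromℕ< _) (trans (m%n%n≡m%n j n) (sym (FinP.toℕ-fromℕ< _))))

    U-block : ∀ {r} k → r < n → U (r + n * k) ≡ cyclicPoint (t (slot r)) k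
    U-block {r} k r<n = cong₂ (λ i k → cyclicPoint (t (π ⟨$⟩ʳ i)) k) (residue-block k r<n) ([r+n*k]/n≡k r k n r<n)

    entry : ℕ → ℕ
    entry j = repEntry (U j) (j / n)

    entry≡interlaced : ∀ {j} (j<qn : j < q * n) → entry j ≡ interlaced (λ i → RepSeq d p q (t i)) π (fromℕ< j<qn)
    entry≡interlaced {j} j<qn = sym (cong₂ (λ i k → repEntry (cyclicPoint (t (π ⟨$⟩ʳ i)) k) k) remainder≡residue quotient≡j/n)
      where
      x = fromℕ< j<qn
      j≡r+n*k : j ≡ toℕ (remainder {q} n x) + n * toℕ (quotient {q} n x)
      j≡r+n*k = trans (sym (FinP.toℕ-fromℕ< j<qn)) (toℕ-remainder+quotient q n x)
      quotient≡j/n : toℕ (quotient {q} n x) ≡ j / n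
      quotient≡j/n = sym (trans (cong (_/ n) j≡r+n*k) ([r+n*k]/n≡k _ _ n (FinP.toℕ<n (remainder {q} n x))))
      remainder≡residue : remainder {q} n x ≡ residue j
      remainder≡residue = FinP.toℕ-injective (trans (sym ([r+n*k]%n≡r _ _ n (FinP.toℕ<n (remainder {q} n x))))
        (trans (cong (_% n) (sym j≡r+n*k)) (sym (FinP.toℕ-fromℕ< _))))

    entry-mono : ∀ {j} → suc j < N → entry j ≤ entry (suc j)
    entry-mono {j} 1+j<N = subst₂ _≤_ (sym (entry≡interlaced j<qn)) (sym (entry≡interlaced 1+j<qn))
      (sorted _ _ (subst₂ _<_ (sym (FinP.toℕ-fromℕ< j<qn)) (sym (FinP.toℕ-fromℕ< 1+j<qn)) (ℕP.n<1+n j)))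
      where
      1+j<qn = subst (suc j <_) (ℕP.*-comm n q) 1+j<N
      j<qn = ℕP.<-trans (ℕP.n<1+n j) 1+j<qn

    dig-U : ∀ {j} → j < N → dig (U j) ≡ entry j + carry (j / n)
    dig-U {j} j<N = OrbitOf.dig-cyclicPoint (slot j) (j/n<q j<N)

    shift : ℕ → ℕ
    shift j = (j + n * p) % N

    j+n*p≡ : ∀ j → j + n * p ≡ j % n + n * (j / n + p)
    j+n*p≡ j = trans (cong (_+ n * p) (m≡m%n+n*[m/n] j n))
      (solve 4 (λ r n k p → r :+ n :* k :+ n :* p := r :+ n :* (k :+ p)) refl (j % n) n (j / n) p)

    shift≡ : ∀ j → shift j ≡ j % n + n * ((j / n + p) % q)
    shift≡ j = trans (cong (λ i → (i + n * p) % N) (m≡m%n+n*[m/n] j n))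
      ([r+n*k+n*p]%[n*q]≡r+n*[[k+p]%q] (j % n) (j / n) p n q (m%n<n j n))

    σ-U : ∀ {j} → j < N → σ d (U j) ≡ U (shift j)
    σ-U {j} j<N = begin
      σ d (cyclicPoint (t (slot j)) (j / n))                ≡⟨ OrbitOf.σ-cyclicPoint (slot j) (j/n<q j<N) ⟩
      cyclicPoint (t (slot j)) ((j / n + p) % q)            ≡⟨ cong (λ i → cyclicPoint (t (π ⟨$⟩ʳ i)) ((j / n + p) % q)) (sym (residue-mod j)) ⟩
      cyclicPoint (t (slot (j % n))) ((j / n + p) % q)      ≡⟨ U-block ((j / n + p) % q) (m%n<n j n) ⟨
      U (j % n + n * ((j / n + p) % q))                     ≡⟨ cong U (shift≡ j) ⟨
      U (shift j)                                           ∎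
      where open ≡-Reasoning

    j+n*p<N : ∀ j → j / n + p < q → j + n * p < N
    j+n*p<N j no-wrap = subst (_< N) (sym (j+n*p≡ j)) (r+n*k<n*q (m%n<n j n) no-wrap)

    N≤j+n*p : ∀ j → q ≤ j / n + p → N ≤ j + n * p
    N≤j+n*p j wrap = ℕP.≤-trans (ℕP.*-monoʳ-≤ n wrap) (subst (n * (j / n + p) ≤_) (sym (j+n*p≡ j)) (ℕP.m≤n+m _ (j % n)))

    shift-wrap : ∀ {j} → j < N → q ≤ j / n + p → shift j ≡ j + n * p ∸ N
    shift-wrap {j} j<N wrap = m%n≡m∸n (j + n * p) N (N≤j+n*p j wrap) (ℕP.+-mono-< j<N (ℕP.*-monoʳ-< n p<q))

    shift-suc : ∀ {j} → suc j < N → carry (j / n) ≡ carry (suc j / n) → shift (suc j) ≡ suc (shift j)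
    shift-suc {j} 1+j<N same-carry with ℕP.<-≤-connex (j / n + p) q | ℕP.<-≤-connex (suc j / n + p) q
    ... | inj₁ no-wrap | inj₁ no-wrap′ =
      trans (m<n⇒m%n≡m (j+n*p<N (suc j) no-wrap′)) (cong suc (sym (m<n⇒m%n≡m (j+n*p<N j no-wrap))))
    ... | inj₂ wrap | inj₂ wrap′ = begin
      shift (suc j)            ≡⟨ shift-wrap 1+j<N wrap′ ⟩
      suc (j + n * p) ∸ N      ≡⟨ ℕP.+-∸-assoc 1 (N≤j+n*p j wrap) ⟩
      suc (j + n * p ∸ N)      ≡⟨ cong suc (shift-wrap (ℕP.<-trans (ℕP.n<1+n j) 1+j<N) wrap) ⟨
      suc (shift j)            ∎
      where open ≡-Reasoning
    ... | inj₁ no-wrap | inj₂ wrap′ = ⊥-elim (ℕP.0≢1+n (trans (sym (if-<ᵇ-< no-wrap)) (trans same-carry (if-<ᵇ-≥ wrap′))))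
    ... | inj₂ wrap | inj₁ no-wrap′ = ⊥-elim (ℕP.0≢1+n (trans (sym (if-<ᵇ-< no-wrap′)) (trans (sym same-carry) (if-<ᵇ-≥ wrap))))

    Descent : ℕ → Set
    Descent j = suc j < N × U (suc j) ℚ.< U j

    gap : ℕ → ℚ
    gap j = U j ℚ.- U (suc j)

-- The digits of U are nondecreasing, so a descent has equal digits at its ends; σ then maps it
-- to a descent, multiplying the gap by d.
    descent-shift : ∀ {j} → Descent j → Descent (shift j) × gap j ℚ.< gap (shift j)
    descent-shift {j} (1+j<N , desc) = (1+shift<N , desc′) , gap<
      where
      j<N = ℕP.<-trans (ℕP.n<1+n j) 1+j<N
      0≤U : ∀ i → 0ℚ ℚ.≤ U i
      0≤U i = proj₁ (U-In𝕋 i)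
      carry≤ : carry (j / n) ≤ carry (suc j / n)
      carry≤ = carry-mono (/-monoˡ-≤ n (ℕP.n≤1+n j))
      same-dig : dig (U j) ≡ dig (U (suc j))
      same-dig = ℕP.≤-antisym
        (subst₂ _≤_ (sym (dig-U j<N)) (sym (dig-U 1+j<N)) (ℕP.+-mono-≤ (entry-mono 1+j<N) carry≤))
        (dig-mono-≤ (0≤U (suc j)) (0≤U j) (ℚP.<⇒≤ desc))
      same-carry : carry (j / n) ≡ carry (suc j / n)
      same-carry = ℕP.≤-antisym carry≤ (ℕP.≮⇒≥ λ carry< → ℕP.<-irrefl (trans (sym (dig-U j<N)) (trans same-dig (dig-U 1+j<N)))
        (ℕP.+-mono-≤-< (entry-mono 1+j<N) carry<))
      shift-suc≡ = shift-suc 1+j<N same-carry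
      1+shift<N : suc (shift j) < N
      1+shift<N = subst (_< N) shift-suc≡ (m%n<n (suc j + n * p) N)
      σ-U-suc : σ d (U (suc j)) ≡ U (suc (shift j))
      σ-U-suc = trans (σ-U 1+j<N) (cong U shift-suc≡)
      desc′ : U (suc (shift j)) ℚ.< U (shift j)
      desc′ = subst₂ ℚ._<_ σ-U-suc (σ-U j<N) (σ-mono-sameDigit (0≤U (suc j)) (0≤U j) (sym same-dig) desc)
      gap< : gap j ℚ.< gap (shift j)
      gap< = subst (gap j ℚ.<_) (cong₂ ℚ._-_ (σ-U j<N) σ-U-suc) (σ-expands-sameDigit (0≤U (suc j)) (0≤U j) (sym same-dig) desc)

    shiftⁱ : ℕ → ℕ → ℕ
    shiftⁱ zero    j = j
    shiftⁱ (suc l) j = shift (shiftⁱ l j)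

    descent-shiftⁱ : ∀ {j} l → Descent j → Descent (shiftⁱ (suc l) j) × gap j ℚ.< gap (shiftⁱ (suc l) j)
    descent-shiftⁱ zero    desc = descent-shift desc
    descent-shiftⁱ (suc l) desc with descent-shiftⁱ l desc
    ... | desc′ , gap< = proj₁ (descent-shift desc′) , ℚP.<-trans gap< (proj₂ (descent-shift desc′))

    shiftⁱ≡ : ∀ {j} l → j < N → shiftⁱ l j ≡ (j + l * (n * p)) % N
    shiftⁱ≡ {j} zero j<N = sym (trans (cong (_% N) (ℕP.+-identityʳ j)) (m<n⇒m%n≡m j<N))
    shiftⁱ≡ {j} (suc l) j<N = trans (cong shift (shiftⁱ≡ l j<N)) (trans ([m%n+o]%n≡[m+o]%n (j + l * (n * p)) (n * p) N)
      (cong (_% N) (solve 3 (λ j l x → j :+ l :* x :+ x := j :+ (x :+ l :* x)) refl j l (n * p))))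

    shiftⁱ-period : ∀ {j} → j < N → shiftⁱ q j ≡ j
    shiftⁱ-period {j} j<N = trans (shiftⁱ≡ q j<N) (trans
      (cong (λ x → (j + x) % N) (solve 3 (λ q n p → q :* (n :* p) := p :* (n :* q)) refl q n p))
      (trans ([m+kn]%n≡m%n j p N) (m<n⇒m%n≡m j<N)))

    U-mono-suc : ∀ {j} → suc j < N → U j ℚ.≤ U (suc j)
    U-mono-suc {j} 1+j<N = ℚP.≮⇒≥ λ desc → ℚP.<-irrefl (cong gap (sym (shiftⁱ-period (ℕP.<-trans (ℕP.n<1+n j) 1+j<N))))
      (proj₂ (descent-shiftⁱ (suc q₀) (1+j<N , desc)))

    cyclicPoint-≡⇒t-≡ : ∀ {a b k k′} → k < q → k′ < q → cyclicPoint (t a) k ≡ cyclicPoint (t b) k′ → t a ≡ t b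
    cyclicPoint-≡⇒t-≡ {a} {b} {k} {k′} k<q k′<q same =
      ℚP.≤-antisym (least-≤ {a} {b} {k} {k′} k′<q same) (least-≤ {b} {a} {k′} {k} k<q (sym same))
      where
      least-≤ : ∀ {a b k k′} → k′ < q → cyclicPoint (t a) k ≡ cyclicPoint (t b) k′ → t a ℚ.≤ t b
      least-≤ {a} {b} {k} {k′} k′<q same = proj₂ (least a) (t b)
        (Orbit-trans ((k * p*) % q , refl) (subst (λ x → Orbit d x (t b)) (sym same) (OrbitOf.t∈orbit-cyclicPoint b {k′} k′<q)))

    U-inside-block : ∀ {j} → suc (j % n) < n → U (suc j) ≡ cyclicPoint (t (slot (suc (j % n)))) (j / n)
    U-inside-block {j} 1+r<n = trans (cong U (cong suc (m≡m%n+n*[m/n] j n))) (U-block (j / n) 1+r<n)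

    1+j≡n*[1+j/n] : ∀ {j} → suc (j % n) ≡ n → suc j ≡ n * suc (j / n)
    1+j≡n*[1+j/n] {j} 1+r≡n = trans (cong suc (m≡m%n+n*[m/n] j n)) (trans (cong (_+ n * (j / n)) 1+r≡n) (sym (ℕP.*-suc n (j / n))))

    U-at-block-end : ∀ {j} → suc (j % n) ≡ n → U (suc j) ≡ cyclicPoint (t (slot 0)) (suc (j / n))
    U-at-block-end {j} 1+r≡n = trans (cong U (1+j≡n*[1+j/n] 1+r≡n)) (U-block (suc (j / n)) (s≤s z≤n))

    U-mod : ∀ j → U j ≡ cyclicPoint (t (slot (j % n))) (j / n)
    U-mod j = cong (λ i → cyclicPoint (t (π ⟨$⟩ʳ i)) (j / n)) (sym (residue-mod j))

    differsFromNext : ℕ → ℕ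
    differsFromNext r = if does (t (slot r) ℚP.≟ t (slot (suc r))) then 0 else 1

-- With r = j % n, 1 exactly when U j < U (suc j): at the end of a block, or when the next slot
-- holds another orbit. So rank j counts the distinct points before U j.
    newOrbit : ℕ → ℕ
    newOrbit r = if does (suc r ≟ n) then 1 else differsFromNext r

    newOrbit-end : ∀ {r} → suc r ≡ n → newOrbit r ≡ 1
    newOrbit-end {r} 1+r≡n = cong (if_then 1 else differsFromNext r) (dec-true (suc r ≟ n) 1+r≡n)

    newOrbit-same : ∀ {r} → suc r ≢ n → t (slot r) ≡ t (slot (suc r)) → newOrbit r ≡ 0
    newOrbit-same {r} 1+r≢n same = trans (cong (if_then 1 else differsFromNext r) (dec-false (suc r ≟ n) 1+r≢n))
      (cong (if_then 0 else 1) (dec-true (t (slot r) ℚP.≟ t (slot (suc r))) same))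

    newOrbit-diff : ∀ {r} → suc r ≢ n → t (slot r) ≢ t (slot (suc r)) → newOrbit r ≡ 1
    newOrbit-diff {r} 1+r≢n diff = trans (cong (if_then 1 else differsFromNext r) (dec-false (suc r ≟ n) 1+r≢n))
      (cong (if_then 0 else 1) (dec-false (t (slot r) ℚP.≟ t (slot (suc r))) diff))

    newOrbit-step : ∀ {j} → suc j < N →
      (newOrbit (j % n) ≡ 0 × U j ≡ U (suc j)) ⊎ (newOrbit (j % n) ≡ 1 × U j ℚ.< U (suc j))
    newOrbit-step {j} 1+j<N with suc (j % n) ≟ n
    ... | yes 1+r≡n = inj₂ (newOrbit-end 1+r≡n , ≤∧≢⇒< (U-mono-suc 1+j<N) λ same →
            let same′ = trans (sym (U-mod j)) (trans same (U-at-block-end 1+r≡n)) in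
            ℚP.<-irrefl (trans (cong (λ x → cyclicPoint x k) (sym (cyclicPoint-≡⇒t-≡ (ℕP.<-trans (ℕP.n<1+n k) 1+k<q) 1+k<q same′))) same′)
              (OrbitOf.cyclicPoint-< (slot 0) (ℕP.n<1+n k) 1+k<q))
      where
      k = j / n
      1+k<q : suc k < q
      1+k<q = ℕP.*-cancelˡ-< n (suc k) q (subst (_< N) (1+j≡n*[1+j/n] 1+r≡n) 1+j<N)
    ... | no 1+r≢n = case t (slot (j % n)) ℚP.≟ t (slot (suc (j % n))) of λ
      { (yes same-t) → inj₁ (newOrbit-same 1+r≢n same-t ,
          trans (U-mod j) (trans (cong (λ x → cyclicPoint x (j / n)) same-t) (sym (U-inside-block 1+r<n))))
      ; (no diff-t) → inj₂ (newOrbit-diff 1+r≢n diff-t , ≤∧≢⇒< (U-mono-suc 1+j<N) λ same →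
          diff-t (cyclicPoint-≡⇒t-≡ (j/n<q j<N) (j/n<q j<N) (trans (sym (U-mod j)) (trans same (U-inside-block 1+r<n)))))
      }
      where
      1+r<n = ℕP.≤∧≢⇒< (m%n<n j n) 1+r≢n
      j<N = ℕP.<-trans (ℕP.n<1+n j) 1+j<N

    rank : ℕ → ℕ
    rank zero    = 0
    rank (suc j) = rank j + newOrbit (j % n)

    rank-+n : ∀ j → rank (j + n) ≡ rank j + rank n
    rank-+n zero    = refl
    rank-+n (suc j) = begin
      rank (j + n) + newOrbit ((j + n) % n)   ≡⟨ cong₂ _+_ (rank-+n j) (cong newOrbit ([m+n]%n≡m%n j n)) ⟩
      rank j + rank n + newOrbit (j % n)      ≡⟨ solve 3 (λ a e b → a :+ e :+ b := a :+ b :+ e) refl (rank j) (rank n) (newOrbit (j % n)) ⟩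
      rank (suc j) + rank n                   ∎
      where open ≡-Reasoning

    rank-block : ∀ r k → rank (r + n * k) ≡ rank r + rank n * k
    rank-block r zero = trans (cong rank (trans (cong (r +_) (ℕP.*-zeroʳ n)) (ℕP.+-identityʳ r)))
      (sym (trans (cong (rank r +_) (ℕP.*-zeroʳ (rank n))) (ℕP.+-identityʳ (rank r))))
    rank-block r (suc k) = begin
      rank (r + n * suc k)         ≡⟨ cong rank (solve 3 (λ r n k → r :+ n :* (con 1 :+ k) := r :+ n :* k :+ n) refl r n k) ⟩
      rank (r + n * k + n)         ≡⟨ rank-+n (r + n * k) ⟩
      rank (r + n * k) + rank n    ≡⟨ cong (_+ rank n) (rank-block r k) ⟩
      rank r + rank n * k + rank n ≡⟨ solve 3 (λ a e k → a :+ e :* k :+ e := a :+ e :* (con 1 :+ k)) refl (rank r) (rank n) k ⟩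
      rank r + rank n * suc k      ∎
      where open ≡-Reasoning

    newOrbit≤1 : ∀ r → newOrbit r ≤ 1
    newOrbit≤1 r with does (suc r ≟ n) | does (t (slot r) ℚP.≟ t (slot (suc r)))
    ... | true  | _     = ℕP.≤-refl
    ... | false | true  = z≤n
    ... | false | false = ℕP.≤-refl

    rank-mono : ∀ {j j′} → j ≤ j′ → rank j ≤ rank j′
    rank-mono {j} {j′} j≤j′ with ℕP.m≤n⇒m<n∨m≡n j≤j′
    ... | inj₂ refl = ℕP.≤-refl
    ... | inj₁ (s≤s j≤i) = ℕP.≤-trans (rank-mono j≤i) (ℕP.m≤m+n _ _)

    rank-≡⇒U-≡′ : ∀ {j j′} → j ≤ j′ → j′ < N → rank j ≡ rank j′ → U j ≡ U j′
    rank-≡⇒U-≡′ {j} {j′} j≤j′ j′<N same with ℕP.m≤n⇒m<n∨m≡n j≤j′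
    ... | inj₂ refl = refl
    ... | inj₁ (s≤s {n = i} j≤i) with newOrbit-step j′<N
    ...   | inj₁ (_ , Uᵢ≡Uᵢ₊₁) = trans (rank-≡⇒U-≡′ j≤i (ℕP.<-trans (ℕP.n<1+n i) j′<N)
              (ℕP.≤-antisym (rank-mono j≤i) (ℕP.≤-trans (ℕP.m≤m+n _ _) (ℕP.≤-reflexive (sym same))))) Uᵢ≡Uᵢ₊₁
    ...   | inj₂ (new , _) = ⊥-elim (ℕP.<-irrefl same (ℕP.≤-<-trans (rank-mono j≤i)
              (subst (rank i <_) (sym (cong (rank i +_) new)) (subst (rank i <_) (ℕP.+-comm 1 (rank i)) (ℕP.n<1+n (rank i))))))

    rank-<⇒U-<′ : ∀ {j j′} → j ≤ j′ → j′ < N → rank j < rank j′ → U j ℚ.< U j′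
    rank-<⇒U-<′ {j} {j′} j≤j′ j′<N rank< with ℕP.m≤n⇒m<n∨m≡n j≤j′
    ... | inj₂ refl = ⊥-elim (ℕP.<-irrefl refl rank<)
    ... | inj₁ (s≤s {n = i} j≤i) with ℕP.m≤n⇒m<n∨m≡n (rank-mono j≤i) | newOrbit-step j′<N
    ...   | inj₁ rankⱼ<rankᵢ | step = ℚP.<-≤-trans (rank-<⇒U-<′ j≤i i<N rankⱼ<rankᵢ) (Uᵢ≤Uᵢ₊₁ step)
      where
      i<N = ℕP.<-trans (ℕP.n<1+n i) j′<N
      Uᵢ≤Uᵢ₊₁ : (newOrbit (i % n) ≡ 0 × U i ≡ U (suc i)) ⊎ (newOrbit (i % n) ≡ 1 × U i ℚ.< U (suc i)) → U i ℚ.≤ U (suc i)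
      Uᵢ≤Uᵢ₊₁ (inj₁ (_ , eq)) = ℚP.≤-reflexive eq
      Uᵢ≤Uᵢ₊₁ (inj₂ (_ , lt)) = ℚP.<⇒≤ lt
    ...   | inj₂ rankⱼ≡rankᵢ | inj₂ (_ , Uᵢ<Uᵢ₊₁) =
      subst (ℚ._< U (suc i)) (sym (rank-≡⇒U-≡′ j≤i (ℕP.<-trans (ℕP.n<1+n i) j′<N) rankⱼ≡rankᵢ)) Uᵢ<Uᵢ₊₁
    ...   | inj₂ rankⱼ≡rankᵢ | inj₁ (stay , _) =
      ⊥-elim (ℕP.<-irrefl (trans rankⱼ≡rankᵢ (sym (trans (cong (rank i +_) stay) (ℕP.+-identityʳ (rank i))))) rank<)

    rank-≡⇒U-≡ : ∀ {j j′} → j < N → j′ < N → rank j ≡ rank j′ → U j ≡ U j′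
    rank-≡⇒U-≡ {j} {j′} j<N j′<N same with ℕP.≤-total j j′
    ... | inj₁ j≤j′ = rank-≡⇒U-≡′ j≤j′ j′<N same
    ... | inj₂ j′≤j = sym (rank-≡⇒U-≡′ j′≤j j<N (sym same))

    rank-<⇒U-< : ∀ {j j′} → j′ < N → rank j < rank j′ → U j ℚ.< U j′
    rank-<⇒U-< {j} {j′} j′<N rank< =
      rank-<⇒U-<′ {j} {j′} (ℕP.≮⇒≥ λ j′<j → ℕP.<⇒≱ rank< (rank-mono (ℕP.<⇒≤ j′<j))) j′<N rank<

    rank-surjective : ∀ {x} j → x ≤ rank j → ∃[ i ] (i ≤ j × rank i ≡ x)
    rank-surjective {x} zero x≤0 = 0 , z≤n , sym (ℕP.n≤0⇒n≡0 x≤0)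
    rank-surjective {x} (suc j) x≤rank with ℕP.≤-<-connex x (rank j)
    ... | inj₁ x≤rankⱼ = let (i , i≤j , rankᵢ≡x) = rank-surjective j x≤rankⱼ in i , ℕP.m≤n⇒m≤1+n i≤j , rankᵢ≡x
    ... | inj₂ rankⱼ<x = suc j , ℕP.≤-refl , ℕP.≤-antisym
          (ℕP.≤-trans (ℕP.+-monoʳ-≤ (rank j) (newOrbit≤1 (j % n))) (subst (_≤ x) (ℕP.+-comm 1 (rank j)) rankⱼ<x)) x≤rank

    E : ℕ
    E = suc (rank n₀)

    rank-n : rank n ≡ E
    rank-n = trans (cong (rank n₀ +_) (newOrbit-end (cong suc (m<n⇒m%n≡m (ℕP.n<1+n n₀))))) (ℕP.+-comm (rank n₀) 1)

    rank<E : ∀ {r} → r < n → rank r < E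
    rank<E r<n = s≤s (rank-mono (ℕP.≤-pred r<n))

    rank-block-E : ∀ r k → rank (r + n * k) ≡ rank r + E * k
    rank-block-E r k = trans (rank-block r k) (cong (λ e → rank r + e * k) rank-n)

    representative : ℕ → ℕ
    representative x = proj₁ (rank-surjective n₀ (ℕP.≤-pred (m%n<n x E)))

    representative<n : ∀ x → representative x < n
    representative<n x = s≤s (proj₁ (proj₂ (rank-surjective n₀ (ℕP.≤-pred (m%n<n x E)))))

    rank-representative : ∀ x → rank (representative x) ≡ x % E
    rank-representative x = proj₂ (proj₂ (rank-surjective n₀ (ℕP.≤-pred (m%n<n x E))))

    select : ℕ → ℕ
    select x = representative x + n * (x / E)

    x/E<q : ∀ {x} → x < E * q → x / E < q
    x/E<q {x} x<Eq = m<n*o⇒m/o<n (subst (x <_) (ℕP.*-comm E q) x<Eq)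

    select<N : ∀ {x} → x < E * q → select x < N
    select<N {x} x<Eq = r+n*k<n*q (representative<n x) (x/E<q x<Eq)

    rank-select : ∀ {x} → x < E * q → rank (select x) ≡ x
    rank-select {x} x<Eq = begin
      rank (representative x + n * (x / E))   ≡⟨ rank-block-E (representative x) (x / E) ⟩
      rank (representative x) + E * (x / E)   ≡⟨ cong (_+ E * (x / E)) (rank-representative x) ⟩
      x % E + E * (x / E)                     ≡⟨ m≡m%n+n*[m/n] x E ⟨
      x                                       ∎
      where open ≡-Reasoning

    rank-shift-select : ∀ {x} → x < E * q → rank (shift (select x)) ≡ (x + E * p) % (E * q)
    rank-shift-select {x} x<Eq = begin
      rank (shift (select x))                                    ≡⟨ cong rank ([r+n*k+n*p]%[n*q]≡r+n*[[k+p]%q] _ (x / E) p n q (representative<n x)) ⟩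
      rank (representative x + n * ((x / E + p) % q))            ≡⟨ rank-block-E (representative x) _ ⟩
      rank (representative x) + E * ((x / E + p) % q)            ≡⟨ cong (_+ E * ((x / E + p) % q)) (rank-representative x) ⟩
      x % E + E * ((x / E + p) % q)                              ≡⟨ [r+n*k+n*p]%[n*q]≡r+n*[[k+p]%q] (x % E) (x / E) p E q (m%n<n x E) ⟨
      (x % E + E * (x / E) + E * p) % (E * q)                    ≡⟨ cong (λ y → (y + E * p) % (E * q)) (m≡m%n+n*[m/n] x E) ⟨
      (x + E * p) % (E * q)                                      ∎
      where open ≡-Reasoning

    unionEnumeration : Enumeration (Union t)
    unionEnumeration = record
      { g′ = rank n₀ ; point = point ; point-< = point-< ; point-σ = point-σ ; point-∈ = point-∈ ; ∈⇒point = ∈⇒point }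
      where
      point : ℕ → ℚ
      point x = U (select x)
      point-< : ∀ {x y} → x < y → y < E * q → point x ℚ.< point y
      point-< {x} {y} x<y y<Eq = rank-<⇒U-< {select x} (select<N y<Eq)
        (subst₂ _<_ (sym (rank-select (ℕP.<-trans x<y y<Eq))) (sym (rank-select y<Eq)) x<y)
      point-σ : ∀ {x} → x < E * q → σ d (point x) ≡ point ((x + E * p) % (E * q))
      point-σ {x} x<Eq = trans (σ-U (select<N x<Eq)) (rank-≡⇒U-≡ (m%n<n (select x + n * p) N) (select<N y<Eq)
        (trans (rank-shift-select x<Eq) (sym (rank-select y<Eq))))
        where y<Eq = m%n<n (x + E * p) (E * q)
      point-∈ : ∀ {x} → x < E * q → Union t (point x)
      point-∈ {x} _ = slot (select x) , (select x / n * p*) % q , refl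
      ∈⇒point : ∀ {z} → Union t z → ∃[ x ] (x < E * q × point x ≡ z)
      ∈⇒point {z} (i , z∈orbit) = rank (r + n * k) , x<Eq , (begin
        U (select (rank (r + n * k)))    ≡⟨ rank-≡⇒U-≡ (select<N x<Eq) (r+n*k<n*q r<n k<q) (rank-select x<Eq) ⟩
        U (r + n * k)                    ≡⟨ U-block k r<n ⟩
        cyclicPoint (t (slot r)) k       ≡⟨ cong (λ i → cyclicPoint (t i) k) slot-r≡i ⟩
        cyclicPoint (t i) k              ≡⟨ proj₂ (proj₂ (OrbitOf.orbit⇒cyclicPoint i z∈orbit)) ⟩
        z                                ∎)
        where
        open ≡-Reasoning
        k = proj₁ (OrbitOf.orbit⇒cyclicPoint i z∈orbit)
        k<q = proj₁ (proj₂ (OrbitOf.orbit⇒cyclicPoint i z∈orbit))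
        r = toℕ (π ⟨$⟩ˡ i)
        r<n = FinP.toℕ<n (π ⟨$⟩ˡ i)
        slot-r≡i : slot r ≡ i
        slot-r≡i = trans (cong (π ⟨$⟩ʳ_) (FinP.toℕ-injective (trans (FinP.toℕ-fromℕ< _) (m<n⇒m%n≡m r<n)))) (inverseʳ π)
        x<Eq : rank (r + n * k) < E * q
        x<Eq = subst (_< E * q) (sym (rank-block-E r k)) (r+n*k<n*q (rank<E r<n) k<q)

corollary3p4 : (d p q n : ℕ) → 2 ≤ d → 2 ≤ q → 1 ≤ p → p < q → gcd p q ≡ 1 → 1 ≤ n →
    (t : Fin n → ℚ) →
    (∀ i → In𝕋 (t i)) →
    (∀ i → Rotational d (Orbit d (t i)) (p ÷ q)) →
    (∀ i → IsLeast (Orbit d (t i)) (t i)) →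
    Rotational d (λ x → ∃[ i ] Orbit d (t i) x) (p ÷ q)
      ⇔ CanInterlace d q n (λ i → RepSeq d p q (t i))
corollary3p4 d p (2+ q₀) (suc n₀) 2≤d (s≤s (s≤s _)) 1≤p p<q gcd≡1 (s≤s _) t t∈𝕋 rot least = mk⇔
  (λ union-rotational → Forward.canInterlace t t∈𝕋 least (Rotational⇒Enumeration union-rotational))
  (λ can-interlace → let (π , sorted) = CanInterlace⇒sorted d q (suc n₀) (λ i → RepSeq d p q (t i)) can-interlace in
    Enumeration⇒Rotational (Backward.unionEnumeration n₀ t t∈𝕋 rot least π sorted))
  where open Rotation d p q₀ 2≤d 1≤p p<q gcd≡1
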